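{- For every $n\ge1$, the B-code is a bijection from $B_n$ to $\mathrm{SE}^{\mathrm B}_n$, and for every $\sigma\in B_n$, $$\mathrm{Cyc_B}\,\sigma=\mathrm{Max}(\text{B-code}\,\sigma)\qquad\text{and}\qquad \mathrm{Lmap_B}\,\sigma=\mathrm{Rmil_B}(\text{B-code}\,\sigma).$$
   Context: $B_n$ is the group of bijections $\sigma$ of $\{\pm1,\ldots,\pm n\}$ with $\sigma(-i)=-\sigma(i)$, written $\sigma_1\cdots\sigma_n$ with $\sigma_i=\sigma(i)$. The B-code of $\sigma$ is $(b_1,\ldots,b_n)$ where $k_i$ is the smallest integer $k\ge1$ with $|\sigma^{ -k}(i)|\le i$ and $b_i=\sigma^{ -k_i}(i)$. $\mathrm{SE}^{\mathrm B}_n$ is the set of integer sequences $(a_1,\ldots,a_n)$ with $a_i\in[-i,i]\setminus\{0\}$, and $\mathrm{Max}\,a=\{i:a_i=i\}$. Let $|\sigma|$ be the permutation of $[n]$ with $|\sigma|(i)=|\sigma(i)|$; a cycle $C$ of $|\sigma|$ is balanced if the number of $i\in C$ with $\sigma(i)<0$ is even. $\mathrm{Cyc_B}\,\sigma$ is the set of minimal elements of the balanced cycles of $|\sigma|$. For an integer word $\omega=\omega_1\cdots\omega_n$: $\mathrm{Lmap_B}\,\omega=\{i:\omega_i>|\omega_j|\ \forall j<i\}$, $\mathrm{Rmil_B}\,\omega=\{\omega_i:0<\omega_i<|\omega_j|\ \forall j>i\}$ (applied to $\sigma$ via its word $\sigma_1\cdots\sigma_n$, and to codes as words). -}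

module Defs where

open import Data.Nat as ℕ using (ℕ; zero; suc)
open import Data.Nat.Divisibility using (_∣_)
open import Data.Integer as ℤ using (ℤ; +_; -[1+_]; -_; ∣_∣)
import Data.Integer.Properties as ℤP
open import Data.Bool using (Bool; true; false; if_then_else_)
open import Data.List using (List; []; _∷_; map; upTo; length; filterᵇ; concatMap)
open import Data.Bool.ListAction using (any)
open import Data.Vec using (Vec; []; _∷_; tabulate)
open import Data.Fin using (Fin; toℕ)
open import Data.Product using (Σ; _×_; ∃)
open import Function using (_∘_)
open import Relation.Nullary using (¬_; does)
open import Relation.Binary.PropositionalEquality using (_≡_; _≢_)

-- Words and the signed permutation they encode.
-- An element σ of B_n is written as its word σ₁⋯σₙ : Vec ℤ n.
-- `at w i` is the 1-based entry w_i (0 when i ∉ [1,n]).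

at : ∀ {n} → Vec ℤ n → ℕ → ℤ
at []       _             = + 0
at (x ∷ xs) zero          = + 0
at (x ∷ xs) (suc zero)    = x
at (x ∷ xs) (suc (suc k)) = at xs (suc k)

app : ∀ {n} → Vec ℤ n → ℤ → ℤ
app w (+ k)     = at w k
app w -[1+ k ]  = - at w (suc k)

[1‥_] : ℕ → List ℕ
[1‥ n ] = map suc (upTo n)

InPM : ℕ → ℤ → Set
InPM n x = x ≢ + 0 × ∣ x ∣ ℕ.≤ n

pmList : ℕ → List ℤ
pmList n = concatMap (λ i → + i ∷ - (+ i) ∷ []) [1‥ n ]

-- σ ∈ B_n : the word induces a bijection of {±1,…,±n}
-- (oddness σ(-i) = -σ(i) holds by construction of `app`).
IsBn : ∀ {n} → Vec ℤ n → Set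
IsBn {n} w =
  (∀ x → InPM n x → InPM n (app w x)) ×
  (∀ x y → InPM n x → InPM n y → app w x ≡ app w y → x ≡ y) ×
  (∀ y → InPM n y → ∃ λ x → InPM n x × app w x ≡ y)

findPre : ∀ {n} → Vec ℤ n → ℤ → List ℤ → ℤ
findPre w y []       = y
findPre w y (x ∷ xs) = if does (app w x ℤP.≟ y) then x else findPre w y xs

inv : ∀ {n} → Vec ℤ n → ℤ → ℤ
inv {n} w y = findPre w y (pmList n)

invPow : ∀ {n} → Vec ℤ n → ℕ → ℤ → ℤ
invPow w zero    x = x
invPow w (suc k) x = inv w (invPow w k x)

-- B-code: b_i = σ^{-k_i}(i), k_i the least k ≥ 1 with |σ^{-k}(i)| ≤ i.
-- Searched over k = 1,2,…,2n (the least such k is always ≤ 2n for σ ∈ B_n,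
-- since the σ⁻¹-orbit of i in ±[n] returns to i after ≤ 2n steps).

firstHit : ∀ {n} → Vec ℤ n → ℕ → List ℕ → ℤ
firstHit w i []       = + i
firstHit w i (k ∷ ks) =
  if does (∣ invPow w k (+ i) ∣ ℕ.≤? i) then invPow w k (+ i) else firstHit w i ks

bcode : ∀ {n} → Vec ℤ n → Vec ℤ n
bcode {n} w = tabulate (λ (j : Fin n) → firstHit w (suc (toℕ j)) [1‥ 2 ℕ.* n ])

IsSE : ∀ {n} → Vec ℤ n → Set
IsSE {n} a = ∀ i → 1 ℕ.≤ i → i ℕ.≤ n → at a i ≢ + 0 × ∣ at a i ∣ ℕ.≤ i

Max : ∀ {n} → Vec ℤ n → ℕ → Set
Max {n} a i = 1 ℕ.≤ i × i ℕ.≤ n × at a i ≡ + i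

absσ : ∀ {n} → Vec ℤ n → ℕ → ℕ
absσ w i = ∣ at w i ∣

absPow : ∀ {n} → Vec ℤ n → ℕ → ℕ → ℕ
absPow w zero    i = i
absPow w (suc k) i = absσ w (absPow w k i)

-- j lies in the |σ|-cycle of m (cycles have length ≤ n)
inCycleᵇ : ∀ {n} → Vec ℤ n → ℕ → ℕ → Bool
inCycleᵇ {n} w m j = any (λ k → does (absPow w k m ℕ.≟ j)) (upTo n)

negᵇ : ∀ {n} → Vec ℤ n → ℕ → Bool
negᵇ w j = does (at w j ℤP.<? + 0)

negCount : ∀ {n} → Vec ℤ n → ℕ → ℕ
negCount {n} w m =
  length (filterᵇ (λ j → if inCycleᵇ w m j then negᵇ w j else false) [1‥ n ])

Cyc : ∀ {n} → Vec ℤ n → ℕ → Set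
Cyc {n} w m =
  1 ℕ.≤ m × m ℕ.≤ n ×
  (∀ k → m ℕ.≤ absPow w k m) ×
  2 ∣ negCount w m

-- Lmap_B ω = { i : ω_i > |ω_j| ∀ j < i }  (with ω_i > 0, i.e. ω₀ = 0)

Lmap : ∀ {n} → Vec ℤ n → ℕ → Set
Lmap {n} ω i =
  1 ℕ.≤ i × i ℕ.≤ n × + 0 ℤ.< at ω i ×
  (∀ j → 1 ℕ.≤ j → j ℕ.< i → + ∣ at ω j ∣ ℤ.< at ω i)

Rmil : ∀ {n} → Vec ℤ n → ℕ → Set
Rmil {n} ω v = ∃ λ i →
  1 ℕ.≤ i × i ℕ.≤ n × at ω i ≡ + v × 0 ℕ.< v ×
  (∀ j → i ℕ.< j → j ℕ.≤ n → v ℕ.< ∣ at ω j ∣)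

-- Every σ ∈ B_(m+1) arises from a unique σ' ∈ B_m and b = σ⁻¹(m+1) ∈ ±[m+1] by inserting m+1: σ is σ'
-- (extended by the identity on ±(m+1)) composed with the signed transposition τ exchanging b and m+1.
-- The σ⁻¹-orbit of i ≤ m is the σ'⁻¹-orbit with detours through ±(m+1), which lie outside [-i, i]; so the
-- B-code of σ is that of σ' followed by b, and bijectivity follows by induction on m.
-- In |σ| the point m+1 is inserted after |b| in the cycle of |σ'| through |b| (it is a fixed point when
-- |b| = m+1); the two new entries σ(|b|) = sgn(b)(m+1) and σ(m+1) = sgn(b)σ'(|b|) change the number of
-- negative entries of that cycle by 0 or 2. So the balanced cycles of σ are those of σ', plus {m+1} when
-- b = m+1. Finally σ agrees with σ' below position |b| and has the largest possible entry ±(m+1) at |b|,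
-- so the left-to-right maxima of σ are those of σ' below |b|, plus |b| when b > 0; appending b to a code
-- changes its right-to-left minima in exactly the same way.
module Submission where

open import Defs
open import Data.Bool using (Bool; true; false; T; if_then_else_)
open import Data.Empty using (⊥-elim)
open import Data.Fin using (toℕ)
import Data.Fin.Properties as Fin
open import Data.Integer using (ℤ; +_; -[1+_]; -_; ∣_∣; +<+) renaming (_<_ to _<ℤ_)
import Data.Integer.Properties as ℤ
open import Data.List using (List; []; _∷_; _++_; map; upTo; applyUpTo; filterᵇ; length; lookup; concatMap)
open import Data.List.Membership.Propositional using (_∈_; lose; find)
open import Data.List.Membership.Propositional.Properties
  using (∈-map⁺; ∈-map⁻; ∈-upTo⁺; ∈-upTo⁻; ∈-concatMap⁺; ∈-concatMap⁻)
open import Data.List.Properties using (map-upTo; length-map; length-upTo)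
open import Data.List.Relation.Unary.Any using (here; there; index)
open import Data.List.Relation.Unary.Any.Properties using (any⁺; any⁻; lookup-index)
open import Data.Nat using (ℕ; zero; suc; _+_; _*_; _∸_; _≤_; _<_; z≤n; s≤s; s≤s⁻¹; _≤ᵇ_)
import Data.Nat.Properties as ℕ
open import Algebra.Properties.CommutativeSemigroup ℕ.+-commutativeSemigroup using (xy∙z≈zy∙x; xy∙z≈xz∙y)
open import Data.Nat.Divisibility using (_∣_; divides; ∣-refl; ∣m∣n⇒∣m+n; ∣m+n∣m⇒∣n; ∣1⇒≡1)
open import Data.Nat.DivMod using (_%_; _/_; m%n<n; m≡m%n+[m/n]*n)
open import Data.Nat.GeneralisedArithmetic using (fold; fold-+)
open import Data.Product using (∃; _×_; _,_; proj₁; proj₂)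
open import Data.Product.Function.NonDependent.Propositional using (_×-⇔_)
open import Data.Sum using (_⊎_; inj₁; inj₂)
open import Data.Sum.Function.Propositional using (_⊎-⇔_)
open import Data.Vec using (Vec; []; _∷_; _∷ʳ_; tabulate; initLast)
import Data.Vec.Properties as Vec
open import Function using (_∘_; case_of_)
open import Function.Bundles using (_⇔_; mk⇔; Equivalence)
open import Function.Construct.Composition using (_⇔-∘_)
open import Function.Construct.Identity using (⇔-id)
open import Function.Construct.Symmetry using (⇔-sym)
open import Relation.Binary.Definitions using (tri<; tri≈; tri>)
open import Relation.Binary.PropositionalEquality
open import Relation.Nullary using (¬_; yes; no; does)
open import Relation.Nullary.Reflects using (ofʸ; ofⁿ)

InRange : ℕ → ℕ → Set
InRange n j = 1 ≤ j × j ≤ n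

≤1+∧≢⇒≤ : ∀ {i m} → i ≤ suc m → i ≢ suc m → i ≤ m
≤1+∧≢⇒≤ i≤1+m i≢1+m = s≤s⁻¹ (ℕ.≤∧≢⇒< i≤1+m i≢1+m)

≢0⇒1≤∣∣ : ∀ {x} → x ≢ + 0 → 1 ≤ ∣ x ∣
≢0⇒1≤∣∣ {+ zero}    x≢0 = ⊥-elim (x≢0 refl)
≢0⇒1≤∣∣ {+ suc _}   _   = s≤s z≤n
≢0⇒1≤∣∣ { -[1+ _ ]} _   = s≤s z≤n

1≤∣∣⇒≢0 : ∀ {x} → 1 ≤ ∣ x ∣ → x ≢ + 0
1≤∣∣⇒≢0 {+ suc _}   _ ()
1≤∣∣⇒≢0 { -[1+ _ ]} _ ()

∣∣≡⇒± : ∀ {x N} → ∣ x ∣ ≡ N → x ≡ + N ⊎ x ≡ - (+ N)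
∣∣≡⇒± {+ _}       refl = inj₁ refl
∣∣≡⇒± { -[1+ _ ]} refl = inj₂ refl

∣∣≡∣∣⇒≡± : ∀ x y → ∣ x ∣ ≡ ∣ y ∣ → x ≡ y ⊎ x ≡ - y
∣∣≡∣∣⇒≡± x y ∣x∣≡∣y∣ with ∣∣≡⇒± ∣x∣≡∣y∣ | ∣∣≡⇒± {y} refl
... | inj₁ x≡+ | inj₁ y≡+ = inj₁ (trans x≡+ (sym y≡+))
... | inj₂ x≡- | inj₂ y≡- = inj₁ (trans x≡- (sym y≡-))
... | inj₁ x≡+ | inj₂ y≡- = inj₂ (trans x≡+ (trans (sym (ℤ.neg-involutive _)) (cong -_ (sym y≡-))))
... | inj₂ x≡- | inj₁ y≡+ = inj₂ (trans x≡- (cong -_ (sym y≡+)))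

+<⇒<∣∣ : ∀ {n y} → + n <ℤ y → n < ∣ y ∣
+<⇒<∣∣ (+<+ n<k) = n<k

InRange⇒InPM : ∀ {n j} → InRange n j → InPM n (+ j)
InRange⇒InPM (1≤j , j≤n) = 1≤∣∣⇒≢0 1≤j , j≤n

InPM-neg : ∀ {n x} → InPM n x → InPM n (- x)
InPM-neg {x = x} (x≢0 , x≤n) =
  (λ -x≡0 → x≢0 (ℤ.neg-injective -x≡0)) , subst (_≤ _) (sym (ℤ.∣-i∣≡∣i∣ x)) x≤n

InPM-suc : ∀ {n x} → InPM n x → InPM (suc n) x
InPM-suc (x≢0 , x≤n) = x≢0 , ℕ.m≤n⇒m≤1+n x≤n

InPM-pred : ∀ {n x} → InPM (suc n) x → ∣ x ∣ ≢ suc n → InPM n x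
InPM-pred (x≢0 , x≤1+n) ∣x∣≢1+n = x≢0 , ≤1+∧≢⇒≤ x≤1+n ∣x∣≢1+n

InPM⇒∣∣≢suc : ∀ {n x} → InPM n x → ∣ x ∣ ≢ suc n
InPM⇒∣∣≢suc (_ , x≤n) ∣x∣≡1+n = ℕ.<-irrefl ∣x∣≡1+n (s≤s x≤n)

signed : ℤ → ℤ → ℤ
signed (+ _)    y = y
signed -[1+ _ ] y = - y

signed-∣∣ : ∀ b → signed b (+ ∣ b ∣) ≡ b
signed-∣∣ (+ _)    = refl
signed-∣∣ -[1+ _ ] = refl

∣signed∣ : ∀ b y → ∣ signed b y ∣ ≡ ∣ y ∣
∣signed∣ (+ _)    y = refl
∣signed∣ -[1+ _ ] y = ℤ.∣-i∣≡∣i∣ y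

signed-involutive : ∀ b y → signed b (signed b y) ≡ y
signed-involutive (+ _)    y = refl
signed-involutive -[1+ _ ] y = ℤ.neg-involutive y

signed-commute : ∀ (f : ℤ → ℤ) → (∀ y → f (- y) ≡ - f y) →
                 ∀ b y → f (signed b y) ≡ signed b (f y)
signed-commute f f-odd (+ _)    y = refl
signed-commute f f-odd -[1+ _ ] y = f-odd y

at-zero : ∀ {n} (w : Vec ℤ n) → at w 0 ≡ + 0
at-zero []      = refl
at-zero (_ ∷ _) = refl

app-odd : ∀ {n} (w : Vec ℤ n) x → app w (- x) ≡ - app w x
app-odd w (+ zero)  = trans (at-zero w) (cong -_ (sym (at-zero w)))
app-odd w (+ suc _) = refl
app-odd w -[1+ k ]  = sym (ℤ.neg-involutive _)

app≡signed : ∀ {n} (w : Vec ℤ n) x → app w x ≡ signed x (at w ∣ x ∣)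
app≡signed w (+ _)    = refl
app≡signed w -[1+ _ ] = refl

at-∷ʳ : ∀ {m} (v : Vec ℤ m) x i → i ≤ m → at (v ∷ʳ x) i ≡ at v i
at-∷ʳ []          x zero          _         = refl
at-∷ʳ (_ ∷ _)     x zero          _         = refl
at-∷ʳ (_ ∷ _)     x (suc zero)    _         = refl
at-∷ʳ (y ∷ z ∷ v) x (suc (suc i)) (s≤s i≤m) = at-∷ʳ (z ∷ v) x (suc i) i≤m

at-∷ʳ-last : ∀ {m} (v : Vec ℤ m) x → at (v ∷ʳ x) (suc m) ≡ x
at-∷ʳ-last []          x = refl
at-∷ʳ-last (_ ∷ [])    x = refl
at-∷ʳ-last (_ ∷ z ∷ v) x = at-∷ʳ-last (z ∷ v) x

at-injective : ∀ {n} (u v : Vec ℤ n) → (∀ i → InRange n i → at u i ≡ at v i) → u ≡ v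
at-injective []      []      _     = refl
at-injective (x ∷ u) (y ∷ v) u≗v =
  cong₂ _∷_ (u≗v 1 (s≤s z≤n , s≤s z≤n))
            (at-injective u v λ { (suc i) (_ , i≤n) → u≗v (suc (suc i)) (s≤s z≤n , s≤s i≤n) })

oddExt : (ℕ → ℤ) → ℤ → ℤ
oddExt f (+ zero)  = + 0
oddExt f (+ suc k) = f (suc k)
oddExt f -[1+ k ]  = - f (suc k)

oddExt-odd : ∀ f x → oddExt f (- x) ≡ - oddExt f x
oddExt-odd f (+ zero)  = refl
oddExt-odd f (+ suc _) = refl
oddExt-odd f -[1+ _ ]  = sym (ℤ.neg-involutive _)

oddExt-+ : ∀ f {k} → 1 ≤ k → oddExt f (+ k) ≡ f k
oddExt-+ f {suc _} _ = refl

word : ∀ {n} → (ℕ → ℤ) → Vec ℤ n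
word f = tabulate (λ j → f (suc (toℕ j)))

at-word : ∀ n (f : ℕ → ℤ) {i} → InRange n i → at (word {n} f) i ≡ f i
at-word (suc n) f {suc zero}    _             = refl
at-word (suc n) f {suc (suc i)} (_ , s≤s i<n) = at-word n (f ∘ suc) (s≤s z≤n , i<n)

app-word-∘ : ∀ n (G : ℤ → ℤ) (f : ℕ → ℤ) → (∀ y → G (- y) ≡ - G y) → G (+ 0) ≡ + 0 →
             ∀ x → ∣ x ∣ ≤ n → app (word {n} (G ∘ f)) x ≡ G (oddExt f x)
app-word-∘ n G f G-odd G0 (+ zero)  _   = trans (at-zero (word {n} (G ∘ f))) (sym G0)
app-word-∘ n G f G-odd G0 (+ suc k) x≤n = at-word n (G ∘ f) (s≤s z≤n , x≤n)
app-word-∘ n G f G-odd G0 -[1+ k ]  x≤n =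
  trans (cong -_ (at-word n (G ∘ f) (s≤s z≤n , x≤n))) (sym (G-odd (f (suc k))))

range : ℕ → ℕ → List ℕ
range s zero    = []
range s (suc L) = s ∷ range (suc s) L

[1‥]≡range : ∀ n → [1‥ n ] ≡ range 1 n
[1‥]≡range n = trans (map-upTo suc n) (applyUpTo≡range suc 1 n (λ _ → refl))
  where
  applyUpTo≡range : ∀ (f : ℕ → ℕ) s L → (∀ k → f k ≡ s + k) → applyUpTo f L ≡ range s L
  applyUpTo≡range f s zero    _  = refl
  applyUpTo≡range f s (suc L) f≗ = cong₂ _∷_ (trans (f≗ 0) (ℕ.+-identityʳ s))
    (applyUpTo≡range (f ∘ suc) (suc s) L (λ k → trans (f≗ (suc k)) (ℕ.+-suc s k)))

range-∷ʳ : ∀ s L → range s (suc L) ≡ range s L ++ (s + L ∷ [])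
range-∷ʳ s zero    = cong (_∷ []) (sym (ℕ.+-identityʳ s))
range-∷ʳ s (suc L) = cong (s ∷_) (trans (range-∷ʳ (suc s) L)
                                        (cong (λ t → range (suc s) L ++ (t ∷ [])) (sym (ℕ.+-suc s L))))

∈[1‥]⁺ : ∀ {n i} → InRange n i → i ∈ [1‥ n ]
∈[1‥]⁺ {i = suc k} (_ , k<n) = ∈-map⁺ suc (∈-upTo⁺ k<n)

∈[1‥]⁻ : ∀ {n i} → i ∈ [1‥ n ] → InRange n i
∈[1‥]⁻ i∈ with ∈-map⁻ suc i∈
... | k , k∈ , refl = s≤s z≤n , ∈-upTo⁻ k∈

InPM⇒∈pmList : ∀ {n x} → InPM n x → x ∈ pmList n
InPM⇒∈pmList {x = + zero}   (x≢0 , _) = ⊥-elim (x≢0 refl)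
InPM⇒∈pmList {x = + suc _}  (_ , x≤n) = ∈-concatMap⁺ _ (lose (∈[1‥]⁺ (s≤s z≤n , x≤n)) (here refl))
InPM⇒∈pmList {x = -[1+ _ ]} (_ , x≤n) = ∈-concatMap⁺ _ (lose (∈[1‥]⁺ (s≤s z≤n , x≤n)) (there (here refl)))

∈pmList⇒InPM : ∀ {n x} → x ∈ pmList n → InPM n x
∈pmList⇒InPM {n} x∈ with find (∈-concatMap⁻ _ {xs = [1‥ n ]} x∈)
... | i , i∈ , here refl         = InRange⇒InPM (∈[1‥]⁻ i∈)
... | i , i∈ , there (here refl) = InPM-neg (InRange⇒InPM (∈[1‥]⁻ i∈))

length-pmList : ∀ n → length (pmList n) ≡ n + n
length-pmList n =
  trans (length-pairs [1‥ n ]) (cong (λ l → l + l) (trans (length-map suc (upTo n)) (length-upTo n)))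
  where
  length-pairs : ∀ xs → length (concatMap (λ i → + i ∷ - (+ i) ∷ []) xs) ≡ length xs + length xs
  length-pairs []       = refl
  length-pairs (_ ∷ xs) =
    cong suc (trans (cong suc (length-pairs xs)) (sym (ℕ.+-suc (length xs) (length xs))))

findPre-correct : ∀ {n} (w : Vec ℤ n) y xs → (∃ λ x → x ∈ xs × app w x ≡ y) →
                  findPre w y xs ∈ xs × app w (findPre w y xs) ≡ y
findPre-correct w y []       (_ , () , _)
findPre-correct w y (z ∷ xs) pre with app w z ℤ.≟ y
... | yes wz≡y = here refl , wz≡y
... | no wz≢y with pre
...   | x , here refl , wx≡y = ⊥-elim (wz≢y wx≡y)
...   | x , there x∈ , wx≡y with findPre-correct w y xs (x , x∈ , wx≡y)
...     | found∈ , found≡ = there found∈ , found≡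

module Inverse {n} (w : Vec ℤ n) (w∈Bn : IsBn w) where

  app-InPM : ∀ x → InPM n x → InPM n (app w x)
  app-InPM = proj₁ w∈Bn

  app-injective : ∀ x y → InPM n x → InPM n y → app w x ≡ app w y → x ≡ y
  app-injective = proj₁ (proj₂ w∈Bn)

  inv-correct : ∀ y → InPM n y → InPM n (inv w y) × app w (inv w y) ≡ y
  inv-correct y y∈ with proj₂ (proj₂ w∈Bn) y y∈
  ... | x , x∈ , wx≡y with findPre-correct w y (pmList n) (x , InPM⇒∈pmList x∈ , wx≡y)
  ...   | found∈ , found≡ = ∈pmList⇒InPM found∈ , found≡

  inv-InPM : ∀ y → InPM n y → InPM n (inv w y)
  inv-InPM y y∈ = proj₁ (inv-correct y y∈)

  app-inv : ∀ y → InPM n y → app w (inv w y) ≡ y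
  app-inv y y∈ = proj₂ (inv-correct y y∈)

  inv-unique : ∀ x y → InPM n x → app w x ≡ y → inv w y ≡ x
  inv-unique x y x∈ refl = app-injective _ x (inv-InPM _ wx∈) x∈ (app-inv _ wx∈)
    where wx∈ = app-InPM x x∈

  inv-app : ∀ x → InPM n x → inv w (app w x) ≡ x
  inv-app x x∈ = inv-unique x _ x∈ refl

  inv-injective : ∀ x y → InPM n x → InPM n y → inv w x ≡ inv w y → x ≡ y
  inv-injective x y x∈ y∈ eq = trans (sym (app-inv x x∈)) (trans (cong (app w) eq) (app-inv y y∈))

IsBn-fromInverse : ∀ {n} (w : Vec ℤ n) (h : ℤ → ℤ) →
                   (∀ x → InPM n x → InPM n (app w x)) → (∀ y → InPM n y → InPM n (h y)) →
                   (∀ y → InPM n y → app w (h y) ≡ y) → (∀ x → InPM n x → h (app w x) ≡ x) →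
                   IsBn w
IsBn-fromInverse w h w-InPM h-InPM w∘h h∘w =
  w-InPM ,
  (λ x y x∈ y∈ eq → trans (sym (h∘w x x∈)) (trans (cong h eq) (h∘w y y∈))) ,
  (λ y y∈ → h y , h-InPM y y∈ , w∘h y y∈)

-- Orbits of an injective self-map of a finite set

fold-suc : ∀ {A : Set} (f : A → A) x k → fold (f x) f k ≡ fold x f (suc k)
fold-suc f x zero    = refl
fold-suc f x (suc k) = cong f (fold-suc f x k)

module _ {A : Set} (f : A → A) (S : List A)
         (f-∈ : ∀ {x} → x ∈ S → f x ∈ S)
         (f-injective : ∀ {x y} → x ∈ S → y ∈ S → f x ≡ f y → x ≡ y) where

  fold-∈ : ∀ k {x} → x ∈ S → fold x f k ∈ S
  fold-∈ zero    x∈ = x∈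
  fold-∈ (suc k) x∈ = f-∈ (fold-∈ k x∈)

  fold-cancel : ∀ k {x y} → x ∈ S → y ∈ S → fold x f k ≡ fold y f k → x ≡ y
  fold-cancel zero    _  _  eq = eq
  fold-cancel (suc k) x∈ y∈ eq = fold-cancel k x∈ y∈ (f-injective (fold-∈ k x∈) (fold-∈ k y∈) eq)

  -- Pigeonhole on the positions in S of x, f x, …, f^|S| x.
  orbit-returns : ∀ {x} → x ∈ S → ∃ λ p → 1 ≤ p × p ≤ length S × fold x f p ≡ x
  orbit-returns {x} x∈ with Fin.pigeonhole (ℕ.n<1+n (length S)) (λ a → index (fold-∈ (toℕ a) x∈))
  ... | a , b , a<b , same-index =
    p , ℕ.m<n⇒0<n∸m a<b , ℕ.≤-trans (ℕ.m∸n≤m (toℕ b) (toℕ a)) (s≤s⁻¹ (Fin.toℕ<n b)) , sym x≡fᵖx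
    where
    p = toℕ b ∸ toℕ a
    fᵃx≡fᵇx : fold x f (toℕ a) ≡ fold x f (toℕ b)
    fᵃx≡fᵇx = trans (lookup-index (fold-∈ (toℕ a) x∈))
                (trans (cong (lookup S) same-index) (sym (lookup-index (fold-∈ (toℕ b) x∈))))
    fᵇx≡fᵃfᵖx : fold x f (toℕ b) ≡ fold (fold x f p) f (toℕ a)
    fᵇx≡fᵃfᵖx = trans (cong (fold x f) (sym (ℕ.m+[n∸m]≡n (ℕ.<⇒≤ a<b)))) (fold-+ x f (toℕ a))
    x≡fᵖx : x ≡ fold x f p
    x≡fᵖx = fold-cancel (toℕ a) x∈ (fold-∈ p x∈) (trans fᵃx≡fᵇx fᵇx≡fᵃfᵖx)

  orbit-bounded : ∀ {x} → x ∈ S → ∀ k → ∃ λ r → r < length S × fold x f r ≡ fold x f k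
  orbit-bounded {x} x∈ k with orbit-returns x∈
  ... | suc p , _ , p≤len , return = k % suc p , ℕ.<-≤-trans (m%n<n k (suc p)) p≤len , sym (begin
    fold x f k
      ≡⟨ cong (fold x f) (m≡m%n+[m/n]*n k (suc p)) ⟩
    fold x f (k % suc p + (k / suc p) * suc p)
      ≡⟨ fold-+ x f (k % suc p) ⟩
    fold (fold x f ((k / suc p) * suc p)) f (k % suc p)
      ≡⟨ cong (λ y → fold y f (k % suc p)) (periodic (k / suc p)) ⟩
    fold x f (k % suc p)
      ∎)
    where
    open ≡-Reasoning
    periodic : ∀ q → fold x f (q * suc p) ≡ x
    periodic zero    = refl
    periodic (suc q) =
      trans (fold-+ x f (suc p)) (trans (cong (λ y → fold y f (suc p)) (periodic q)) return)

-- The B-code as a first return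

-- Reaches f i x z: iterating f from x, the first value in [-i, i] is z; b_i is the one reached from σ⁻¹(i).
data Reaches (f : ℤ → ℤ) (i : ℕ) : ℤ → ℤ → Set where
  done : ∀ {x}   → ∣ x ∣ ≤ i → Reaches f i x x
  skip : ∀ {x z} → i < ∣ x ∣ → Reaches f i (f x) z → Reaches f i x z

steps : ∀ {f i x z} → Reaches f i x z → ℕ
steps (done _)   = 0
steps (skip _ c) = suc (steps c)

steps-≤ : ∀ {f i x z} (c : Reaches f i x z) d → ∣ fold x f d ∣ ≤ i → steps c ≤ d
steps-≤ (done _)     d       _   = z≤n
steps-≤ (skip i<x _) zero    x≤i = ⊥-elim (ℕ.<⇒≱ i<x x≤i)
steps-≤ {f} {x = x} (skip _ c) (suc d) fᵈx≤i =
  s≤s (steps-≤ c d (subst (λ y → ∣ y ∣ ≤ _) (sym (fold-suc f x d)) fᵈx≤i))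

Reaches-exists : ∀ f i d x → ∣ fold x f d ∣ ≤ i → ∃ (Reaches f i x)
Reaches-exists f i zero    x x≤i   = x , done x≤i
Reaches-exists f i (suc d) x fᵈx≤i with ∣ x ∣ ℕ.≤? i
... | yes x≤i = x , done x≤i
... | no  x≰i with Reaches-exists f i d (f x) (subst (λ y → ∣ y ∣ ≤ i) (sym (fold-suc f x d)) fᵈx≤i)
...   | z , c = z , skip (ℕ.≰⇒> x≰i) c

firstHit-Reaches : ∀ {n} (w : Vec ℤ n) i s L {z} (c : Reaches (inv w) i (invPow w s (+ i)) z) →
                   steps c < L → firstHit w i (range s L) ≡ z
firstHit-Reaches w i s (suc L) c c<L
  with ∣ invPow w s (+ i) ∣ ≤ᵇ i | ℕ.≤ᵇ-reflects-≤ ∣ invPow w s (+ i) ∣ i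
firstHit-Reaches w i s (suc L) (done _)     _   | true  | _       = refl
firstHit-Reaches w i s (suc L) (done x≤i)   _   | false | ofⁿ x≰i = ⊥-elim (x≰i x≤i)
firstHit-Reaches w i s (suc L) (skip i<x _) _   | true  | ofʸ x≤i = ⊥-elim (ℕ.<⇒≱ i<x x≤i)
firstHit-Reaches w i s (suc L) (skip _ c)   c<L | false | _       =
  firstHit-Reaches w i (suc s) L c (s≤s⁻¹ c<L)

module BCode {n} (w : Vec ℤ n) (w∈Bn : IsBn w) where
  open Inverse w w∈Bn

  inv-returns : ∀ {x} → InPM n x → ∃ λ p → 1 ≤ p × p ≤ 2 * n × fold x (inv w) p ≡ x
  inv-returns x∈ =
    case orbit-returns (inv w) (pmList n) (λ y∈ → InPM⇒∈pmList (inv-InPM _ (∈pmList⇒InPM y∈)))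
           (λ x∈ y∈ → inv-injective _ _ (∈pmList⇒InPM x∈) (∈pmList⇒InPM y∈)) (InPM⇒∈pmList x∈) of λ
      { (p , 1≤p , p≤len , return) → p , 1≤p , subst (p ≤_) len≡2n p≤len , return }
    where len≡2n = trans (length-pmList n) (cong (λ k → n + k) (sym (ℕ.+-identityʳ n)))

  inv-comes-back : ∀ {i} → InRange n i → ∃ λ d → d < 2 * n × ∣ fold (inv w (+ i)) (inv w) d ∣ ≤ i
  inv-comes-back {i} i∈ = case inv-returns (InRange⇒InPM i∈) of λ
    { (suc d , _ , p≤2n , return) →
      d , p≤2n , subst (λ y → ∣ y ∣ ≤ i) (sym (trans (fold-suc (inv w) (+ i) d) return)) ℕ.≤-refl }

  inv-Reaches : ∀ {i} → InRange n i → ∃ (Reaches (inv w) i (inv w (+ i)))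
  inv-Reaches {i} i∈ = case inv-comes-back i∈ of λ
    { (d , _ , back) → Reaches-exists (inv w) i d (inv w (+ i)) back }

  bcode-at : ∀ {i z} → InRange n i → Reaches (inv w) i (inv w (+ i)) z → at (bcode w) i ≡ z
  bcode-at {i} {z} i∈ c = case inv-comes-back i∈ of λ { (d , d<2n , back) →
    let steps<2n = ℕ.≤-<-trans (steps-≤ c d back) d<2n in begin
    at (bcode w) i                 ≡⟨ at-word n (λ j → firstHit w j [1‥ 2 * n ]) i∈ ⟩
    firstHit w i [1‥ 2 * n ]       ≡⟨ cong (firstHit w i) ([1‥]≡range (2 * n)) ⟩
    firstHit w i (range 1 (2 * n)) ≡⟨ firstHit-Reaches w i 1 (2 * n) c steps<2n ⟩
    z                              ∎ }
    where open ≡-Reasoning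

-- Insertion

-- The signed transposition of ℤ exchanging b ↔ N and -b ↔ -N, where N = suc m.
module Transposition (m : ℕ) (b : ℤ) where

  N : ℕ
  N = suc m

  τ⁺ : ℕ → ℤ
  τ⁺ k with k ℕ.≟ ∣ b ∣ | k ℕ.≟ N
  ... | yes _ | _     = signed b (+ N)
  ... | no  _ | yes _ = b
  ... | no  _ | no  _ = + k

  τ : ℤ → ℤ
  τ = oddExt τ⁺

  τ⁺-∣b∣ : τ⁺ ∣ b ∣ ≡ signed b (+ N)
  τ⁺-∣b∣ with ∣ b ∣ ℕ.≟ ∣ b ∣
  ... | yes _ = refl
  ... | no ≢  = ⊥-elim (≢ refl)

  τ⁺-N : τ⁺ N ≡ b
  τ⁺-N with N ℕ.≟ ∣ b ∣ | N ℕ.≟ N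
  ... | yes N≡∣b∣ | _     = trans (cong (λ k → signed b (+ k)) N≡∣b∣) (signed-∣∣ b)
  ... | no  _     | yes _ = refl
  ... | no  _     | no ≢  = ⊥-elim (≢ refl)

  τ⁺-other : ∀ k → k ≢ ∣ b ∣ → k ≢ N → τ⁺ k ≡ + k
  τ⁺-other k k≢∣b∣ k≢N with k ℕ.≟ ∣ b ∣ | k ℕ.≟ N
  ... | yes k≡∣b∣ | _     = ⊥-elim (k≢∣b∣ k≡∣b∣)
  ... | no  _     | yes k≡N = ⊥-elim (k≢N k≡N)
  ... | no  _     | no  _ = refl

  τ-odd : ∀ y → τ (- y) ≡ - τ y
  τ-odd = oddExt-odd τ⁺

  module _ (b∈ : InPM N b) where

    τ-N : τ (+ N) ≡ b
    τ-N = τ⁺-N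

    τ-∣b∣ : τ (+ ∣ b ∣) ≡ signed b (+ N)
    τ-∣b∣ = trans (oddExt-+ τ⁺ (≢0⇒1≤∣∣ (proj₁ b∈))) τ⁺-∣b∣

    τ-b : τ b ≡ + N
    τ-b = begin
      τ b                    ≡⟨ cong τ (sym (signed-∣∣ b)) ⟩
      τ (signed b (+ ∣ b ∣)) ≡⟨ signed-commute τ τ-odd b _ ⟩
      signed b (τ (+ ∣ b ∣)) ≡⟨ cong (signed b) τ-∣b∣ ⟩
      signed b (signed b (+ N)) ≡⟨ signed-involutive b _ ⟩
      + N                    ∎
      where open ≡-Reasoning

    τ-involutive⁺ : ∀ k → τ (τ (+ suc k)) ≡ + suc k
    τ-involutive⁺ k with suc k ℕ.≟ ∣ b ∣ | suc k ℕ.≟ N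
    ... | yes k≡∣b∣ | _ = begin
      τ (signed b (+ N)) ≡⟨ signed-commute τ τ-odd b _ ⟩
      signed b (τ (+ N)) ≡⟨ cong (signed b) τ-N ⟩
      signed b b         ≡⟨ cong (signed b) (sym (signed-∣∣ b)) ⟩
      signed b (signed b (+ ∣ b ∣)) ≡⟨ signed-involutive b _ ⟩
      + ∣ b ∣            ≡⟨ cong +_ (sym k≡∣b∣) ⟩
      + suc k            ∎
      where open ≡-Reasoning
    ... | no _ | yes k≡N = trans τ-b (cong +_ (sym k≡N))
    ... | no k≢∣b∣ | no k≢N = τ⁺-other (suc k) k≢∣b∣ k≢N

    τ-involutive : ∀ x → τ (τ x) ≡ x
    τ-involutive (+ zero)  = refl
    τ-involutive (+ suc k) = τ-involutive⁺ k
    τ-involutive -[1+ k ]  = begin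
      τ (τ (- (+ suc k))) ≡⟨ cong τ (τ-odd (+ suc k)) ⟩
      τ (- τ (+ suc k))   ≡⟨ τ-odd (τ (+ suc k)) ⟩
      - τ (τ (+ suc k))   ≡⟨ cong -_ (τ-involutive⁺ k) ⟩
      -[1+ k ]            ∎
      where open ≡-Reasoning

    τ-InPM⁺ : ∀ k → InPM N (+ suc k) → InPM N (τ (+ suc k))
    τ-InPM⁺ k k∈ with suc k ℕ.≟ ∣ b ∣ | suc k ℕ.≟ N
    ... | yes _ | _     = (λ eq → ℕ.1+n≢0 (trans (sym (∣signed∣ b (+ N))) (cong ∣_∣ eq))) ,
                          ℕ.≤-reflexive (∣signed∣ b (+ N))
    ... | no  _ | yes _ = b∈
    ... | no  _ | no  _ = k∈

    τ-InPM : ∀ x → InPM N x → InPM N (τ x)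
    τ-InPM (+ zero)  (x≢0 , _) = ⊥-elim (x≢0 refl)
    τ-InPM (+ suc k) x∈        = τ-InPM⁺ k x∈
    τ-InPM -[1+ k ]  x∈        =
      subst (InPM N) (sym (τ-odd (+ suc k))) (InPM-neg (τ-InPM⁺ k (InPM-neg x∈)))

    τ-fixes-or-hits-N : ∀ x → InPM m x → τ x ≡ x ⊎ ∣ τ x ∣ ≡ N
    τ-fixes-or-hits-N (+ zero)  (x≢0 , _) = ⊥-elim (x≢0 refl)
    τ-fixes-or-hits-N (+ suc k) (_ , k<N) = fixes-or-hits⁺ k k<N
      where
      fixes-or-hits⁺ : ∀ k → suc k ≤ m → τ (+ suc k) ≡ + suc k ⊎ ∣ τ (+ suc k) ∣ ≡ N
      fixes-or-hits⁺ k k<N with suc k ℕ.≟ ∣ b ∣ | suc k ℕ.≟ N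
      ... | yes _ | _       = inj₂ (∣signed∣ b (+ N))
      ... | no  _ | yes k≡N = ⊥-elim (ℕ.<-irrefl k≡N (s≤s k<N))
      ... | no  _ | no  _   = inj₁ refl
    τ-fixes-or-hits-N -[1+ k ]  x∈ with τ-fixes-or-hits-N (+ suc k) (InPM-neg x∈)
    ... | inj₁ fixes = inj₁ (trans (τ-odd (+ suc k)) (cong -_ fixes))
    ... | inj₂ hits  =
      inj₂ (trans (cong ∣_∣ (τ-odd (+ suc k))) (trans (ℤ.∣-i∣≡∣i∣ (τ (+ suc k))) hits))

    τ≡+N⇒≡b : ∀ x → τ x ≡ + N → x ≡ b
    τ≡+N⇒≡b x eq = trans (sym (τ-involutive x)) (trans (cong τ eq) τ-N)

    τ≡-N⇒≡-b : ∀ x → τ x ≡ - (+ N) → x ≡ - b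
    τ≡-N⇒≡-b x eq =
      trans (sym (τ-involutive x)) (trans (cong τ eq) (trans (τ-odd (+ N)) (cong -_ τ-N)))

extend : ℕ → (ℤ → ℤ) → ℤ → ℤ
extend m f y with ∣ y ∣ ℕ.≟ suc m
... | yes _ = y
... | no  _ = f y

module _ (m : ℕ) (f : ℤ → ℤ) where

  extend-N : ∀ y → ∣ y ∣ ≡ suc m → extend m f y ≡ y
  extend-N y ∣y∣≡N with ∣ y ∣ ℕ.≟ suc m
  ... | yes _ = refl
  ... | no ≢  = ⊥-elim (≢ ∣y∣≡N)

  extend-other : ∀ y → ∣ y ∣ ≢ suc m → extend m f y ≡ f y
  extend-other y ∣y∣≢N with ∣ y ∣ ℕ.≟ suc m
  ... | yes ≡ = ⊥-elim (∣y∣≢N ≡)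
  ... | no  _ = refl

  extend-odd : (∀ y → f (- y) ≡ - f y) → ∀ y → extend m f (- y) ≡ - extend m f y
  extend-odd f-odd y with ∣ y ∣ ℕ.≟ suc m
  ... | yes ∣y∣≡N = extend-N (- y) (trans (ℤ.∣-i∣≡∣i∣ y) ∣y∣≡N)
  ... | no  ∣y∣≢N =
    trans (extend-other (- y) (λ eq → ∣y∣≢N (trans (sym (ℤ.∣-i∣≡∣i∣ y)) eq))) (f-odd y)

  extend-InPM : (∀ y → InPM m y → InPM m (f y)) →
                ∀ y → InPM (suc m) y → InPM (suc m) (extend m f y)
  extend-InPM f-InPM y y∈ with ∣ y ∣ ℕ.≟ suc m
  ... | yes _     = y∈
  ... | no  ∣y∣≢N = InPM-suc (f-InPM y (InPM-pred y∈ ∣y∣≢N))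

  extend-inverse : ∀ g → (∀ y → InPM m y → InPM m (g y)) → (∀ y → InPM m y → f (g y) ≡ y) →
                   ∀ y → InPM (suc m) y → extend m f (extend m g y) ≡ y
  extend-inverse g g-InPM f∘g y y∈ with ∣ y ∣ ℕ.≟ suc m
  ... | yes ∣y∣≡N = extend-N y ∣y∣≡N
  ... | no  ∣y∣≢N = trans (extend-other (g y) (InPM⇒∣∣≢suc (g-InPM y y∈′))) (f∘g y y∈′)
    where y∈′ = InPM-pred y∈ ∣y∣≢N

ins : ∀ {m} → Vec ℤ m → ℤ → Vec ℤ (suc m)
ins {m} σ' b = word (extend m (app σ') ∘ Transposition.τ⁺ m b)

module Insertion {m} (σ' : Vec ℤ m) (σ'∈Bn : IsBn σ') (b : ℤ) (b∈ : InPM (suc m) b) where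
  open Transposition m b
  module Old = Inverse σ' σ'∈Bn

  σ : Vec ℤ N
  σ = ins σ' b

  app-ins : ∀ x → InPM N x → app σ x ≡ extend m (app σ') (τ x)
  app-ins x (_ , x≤N) =
    app-word-∘ N (extend m (app σ')) τ⁺ (extend-odd m (app σ') (app-odd σ'))
      (trans (extend-other m (app σ') (+ 0) (λ ())) (at-zero σ')) x x≤N

  ins⁻¹ : ℤ → ℤ
  ins⁻¹ y = τ (extend m (inv σ') y)

  ins⁻¹-InPM : ∀ y → InPM N y → InPM N (ins⁻¹ y)
  ins⁻¹-InPM y y∈ = τ-InPM b∈ _ (extend-InPM m (inv σ') Old.inv-InPM y y∈)

  ins∘ins⁻¹ : ∀ y → InPM N y → app σ (ins⁻¹ y) ≡ y
  ins∘ins⁻¹ y y∈ = begin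
    app σ (ins⁻¹ y)
      ≡⟨ app-ins _ (ins⁻¹-InPM y y∈) ⟩
    extend m (app σ') (τ (τ (extend m (inv σ') y)))
      ≡⟨ cong (extend m (app σ')) (τ-involutive b∈ (extend m (inv σ') y)) ⟩
    extend m (app σ') (extend m (inv σ') y)
      ≡⟨ extend-inverse m (app σ') (inv σ') Old.inv-InPM Old.app-inv y y∈ ⟩
    y ∎
    where open ≡-Reasoning

  ins⁻¹∘ins : ∀ x → InPM N x → ins⁻¹ (app σ x) ≡ x
  ins⁻¹∘ins x x∈ = begin
    ins⁻¹ (app σ x)
      ≡⟨ cong ins⁻¹ (app-ins x x∈) ⟩
    τ (extend m (inv σ') (extend m (app σ') (τ x)))
      ≡⟨ cong τ (extend-inverse m (inv σ') (app σ') Old.app-InPM Old.inv-app (τ x) (τ-InPM b∈ x x∈)) ⟩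
    τ (τ x)
      ≡⟨ τ-involutive b∈ x ⟩
    x ∎
    where open ≡-Reasoning

  ins∈Bn : IsBn σ
  ins∈Bn = IsBn-fromInverse σ ins⁻¹
    (λ x x∈ → subst (InPM N) (sym (app-ins x x∈))
                (extend-InPM m (app σ') Old.app-InPM _ (τ-InPM b∈ x x∈)))
    ins⁻¹-InPM ins∘ins⁻¹ ins⁻¹∘ins

  module New = Inverse σ ins∈Bn

  inv-ins : ∀ y → InPM N y → inv σ y ≡ ins⁻¹ y
  inv-ins y y∈ = New.inv-unique (ins⁻¹ y) y (ins⁻¹-InPM y y∈) (ins∘ins⁻¹ y y∈)

  inv-ins-old : ∀ y → InPM m y → inv σ y ≡ τ (inv σ' y)
  inv-ins-old y y∈ =
    trans (inv-ins y (InPM-suc y∈)) (cong τ (extend-other m (inv σ') y (InPM⇒∣∣≢suc y∈)))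

  inv-ins-N : inv σ (+ N) ≡ b
  inv-ins-N =
    trans (inv-ins (+ N) ((λ ()) , ℕ.≤-refl)) (trans (cong τ (extend-N m (inv σ') (+ N) refl)) (τ-N b∈))

  inv-ins-τ : ∀ x → ∣ τ x ∣ ≡ N → inv σ (τ x) ≡ x
  inv-ins-τ x ∣τx∣≡N =
    trans (inv-ins (τ x) τx∈) (trans (cong τ (extend-N m (inv σ') (τ x) ∣τx∣≡N)) (τ-involutive b∈ x))
    where τx∈ = (λ τx≡0 → ℕ.1+n≢0 (trans (sym ∣τx∣≡N) (cong ∣_∣ τx≡0))) , ℕ.≤-reflexive ∣τx∣≡N

  mutual
    lift-Reaches : ∀ {i x z} → i ≤ m → InPM m x → Reaches (inv σ') i x z → Reaches (inv σ) i x z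
    lift-Reaches i≤m x∈ (done x≤i)  = done x≤i
    lift-Reaches i≤m x∈ (skip i<x c) =
      skip i<x (subst (λ y → Reaches (inv σ) _ y _) (sym (inv-ins-old _ x∈))
                 (lift-Reaches-τ i≤m (Old.inv-InPM _ x∈) c))

    lift-Reaches-τ : ∀ {i x z} → i ≤ m → InPM m x →
                     Reaches (inv σ') i x z → Reaches (inv σ) i (τ x) z
    lift-Reaches-τ i≤m x∈ c with τ-fixes-or-hits-N b∈ _ x∈
    ... | inj₁ τx≡x = subst (λ y → Reaches (inv σ) _ y _) (sym τx≡x) (lift-Reaches i≤m x∈ c)
    ... | inj₂ ∣τx∣≡N =
      skip (subst (_ <_) (sym ∣τx∣≡N) (s≤s i≤m))
           (subst (λ y → Reaches (inv σ) _ y _) (sym (inv-ins-τ _ ∣τx∣≡N)) (lift-Reaches i≤m x∈ c))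

  bcode-ins-last : at (bcode σ) N ≡ b
  bcode-ins-last = BCode.bcode-at σ ins∈Bn (s≤s z≤n , ℕ.≤-refl)
    (subst (λ y → Reaches (inv σ) N y b) (sym inv-ins-N) (done (proj₂ b∈)))

  bcode-ins-old : ∀ {i} → InRange m i → at (bcode σ) i ≡ at (bcode σ') i
  bcode-ins-old {i} i∈@(1≤i , i≤m) = case BCode.inv-Reaches σ' σ'∈Bn i∈ of λ { (z , c) →
    trans (BCode.bcode-at σ ins∈Bn (1≤i , ℕ.m≤n⇒m≤1+n i≤m)
            (subst (λ y → Reaches (inv σ) i y z) (sym (inv-ins-old (+ i) (InRange⇒InPM i∈)))
              (lift-Reaches-τ i≤m (Old.inv-InPM _ (InRange⇒InPM i∈)) c)))
          (sym (BCode.bcode-at σ' σ'∈Bn i∈ c)) }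

  bcode-ins : bcode σ ≡ bcode σ' ∷ʳ b
  bcode-ins = at-injective _ _ λ i (1≤i , i≤N) → case i ℕ.≟ N of λ
    { (yes i≡N) → subst (λ j → at (bcode σ) j ≡ at (bcode σ' ∷ʳ b) j) (sym i≡N)
                    (trans bcode-ins-last (sym (at-∷ʳ-last (bcode σ') b)))
    ; (no  i≢N) → let i≤m = ≤1+∧≢⇒≤ i≤N i≢N in
                  trans (bcode-ins-old (1≤i , i≤m)) (sym (at-∷ʳ (bcode σ') b i i≤m)) }

module Deletion {m} (σ : Vec ℤ (suc m)) (σ∈Bn : IsBn σ) where
  open Inverse σ σ∈Bn
  open Transposition m (inv σ (+ suc m))

  N∈ : InPM N (+ N)
  N∈ = (λ ()) , ℕ.≤-refl

  b : ℤ
  b = inv σ (+ N)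

  b∈ : InPM N b
  b∈ = inv-InPM (+ N) N∈

  σ' : Vec ℤ m
  σ' = word (app σ ∘ τ⁺)

  app-del : ∀ x → ∣ x ∣ ≤ m → app σ' x ≡ app σ (τ x)
  app-del = app-word-∘ m (app σ) τ⁺ (app-odd σ) (at-zero σ)

  app-at-τ⁻¹±N : ∀ x → ∣ τ x ∣ ≡ N → app σ x ≡ τ x
  app-at-τ⁻¹±N x ∣τx∣≡N with ∣∣≡⇒± ∣τx∣≡N
  ... | inj₁ τx≡N  = begin
    app σ x       ≡⟨ cong (app σ) (τ≡+N⇒≡b b∈ x τx≡N) ⟩
    app σ b       ≡⟨ app-inv (+ N) N∈ ⟩
    + N           ≡⟨ sym τx≡N ⟩
    τ x           ∎
    where open ≡-Reasoning
  ... | inj₂ τx≡-N = begin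
    app σ x       ≡⟨ cong (app σ) (τ≡-N⇒≡-b b∈ x τx≡-N) ⟩
    app σ (- b)   ≡⟨ app-odd σ b ⟩
    - app σ b     ≡⟨ cong -_ (app-inv (+ N) N∈) ⟩
    - (+ N)       ≡⟨ sym τx≡-N ⟩
    τ x           ∎
    where open ≡-Reasoning

  ∣app∣≡N⇒∣τ∣≡N : ∀ z → InPM N z → ∣ app σ z ∣ ≡ N → ∣ τ z ∣ ≡ N
  ∣app∣≡N⇒∣τ∣≡N z z∈ ∣σz∣≡N with ∣∣≡⇒± ∣σz∣≡N
  ... | inj₁ σz≡N  = cong ∣_∣ (trans (cong τ (sym (inv-unique z (+ N) z∈ σz≡N))) (τ-b b∈))
  ... | inj₂ σz≡-N = begin
    ∣ τ z ∣         ≡⟨ cong (∣_∣ ∘ τ) (sym (ℤ.neg-involutive z)) ⟩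
    ∣ τ (- (- z)) ∣ ≡⟨ cong (∣_∣ ∘ τ ∘ -_) (sym (inv-unique (- z) (+ N) (InPM-neg z∈) σ-z≡N)) ⟩
    ∣ τ (- b) ∣     ≡⟨ cong ∣_∣ (τ-odd b) ⟩
    ∣ - τ b ∣       ≡⟨ ℤ.∣-i∣≡∣i∣ (τ b) ⟩
    ∣ τ b ∣         ≡⟨ cong ∣_∣ (τ-b b∈) ⟩
    N               ∎
    where
    open ≡-Reasoning
    σ-z≡N : app σ (- z) ≡ + N
    σ-z≡N = trans (app-odd σ z) (trans (cong -_ σz≡-N) (ℤ.neg-involutive (+ N)))

  del-InPM : ∀ x → InPM m x → InPM m (app σ' x)
  del-InPM x x∈ = subst (InPM m) (sym (app-del x (proj₂ x∈)))
    (InPM-pred (app-InPM _ τx∈) λ ∣στx∣≡N →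
      InPM⇒∣∣≢suc x∈ (trans (cong ∣_∣ (sym (τ-involutive b∈ x)))
                            (∣app∣≡N⇒∣τ∣≡N (τ x) τx∈ ∣στx∣≡N)))
    where τx∈ = τ-InPM b∈ x (InPM-suc x∈)

  del⁻¹ : ℤ → ℤ
  del⁻¹ y = τ (inv σ y)

  del⁻¹-InPM : ∀ y → InPM m y → InPM m (del⁻¹ y)
  del⁻¹-InPM y y∈ = InPM-pred (τ-InPM b∈ _ (inv-InPM y y∈′)) λ ∣τσ⁻¹y∣≡N → InPM⇒∣∣≢suc y∈ (begin
    ∣ y ∣               ≡⟨ cong ∣_∣ (sym (app-inv y y∈′)) ⟩
    ∣ app σ (inv σ y) ∣ ≡⟨ cong ∣_∣ (app-at-τ⁻¹±N (inv σ y) ∣τσ⁻¹y∣≡N) ⟩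
    ∣ τ (inv σ y) ∣     ≡⟨ ∣τσ⁻¹y∣≡N ⟩
    N                   ∎)
    where
    open ≡-Reasoning
    y∈′ = InPM-suc y∈

  del∈Bn : IsBn σ'
  del∈Bn = IsBn-fromInverse σ' del⁻¹ del-InPM del⁻¹-InPM
    (λ y y∈ → begin
      app σ' (del⁻¹ y)      ≡⟨ app-del (del⁻¹ y) (proj₂ (del⁻¹-InPM y y∈)) ⟩
      app σ (τ (τ (inv σ y))) ≡⟨ cong (app σ) (τ-involutive b∈ (inv σ y)) ⟩
      app σ (inv σ y)       ≡⟨ app-inv y (InPM-suc y∈) ⟩
      y                     ∎)
    (λ x x∈ → begin
      del⁻¹ (app σ' x)       ≡⟨ cong del⁻¹ (app-del x (proj₂ x∈)) ⟩
      τ (inv σ (app σ (τ x))) ≡⟨ cong τ (inv-app (τ x) (τ-InPM b∈ x (InPM-suc x∈))) ⟩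
      τ (τ x)                ≡⟨ τ-involutive b∈ x ⟩
      x                      ∎)
    where open ≡-Reasoning

  ins-del : ins σ' b ≡ σ
  ins-del = at-injective _ _ λ { (suc k) (_ , k<N) → let k∈ = ((λ ()) , k<N) in
    trans (Insertion.app-ins σ' del∈Bn b b∈ (+ suc k) k∈) (agree (+ suc k) k∈) }
    where
    agree : ∀ x → InPM N x → extend m (app σ') (τ x) ≡ app σ x
    agree x x∈ with ∣ τ x ∣ ℕ.≟ N
    ... | yes ∣τx∣≡N = sym (app-at-τ⁻¹±N x ∣τx∣≡N)
    ... | no  ∣τx∣≢N = begin
      app σ' (τ x)            ≡⟨ app-del (τ x) (proj₂ (InPM-pred (τ-InPM b∈ x x∈) ∣τx∣≢N)) ⟩
      app σ (τ (τ x))         ≡⟨ cong (app σ) (τ-involutive b∈ x) ⟩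
      app σ x                 ∎
      where open ≡-Reasoning


record Decomposition {m} (σ : Vec ℤ (suc m)) : Set where
  field
    σ'    : Vec ℤ m
    b     : ℤ
    σ'∈Bn : IsBn σ'
    b∈    : InPM (suc m) b
    ins≡  : ins σ' b ≡ σ

  bcode≡ : bcode σ ≡ bcode σ' ∷ʳ b
  bcode≡ = trans (cong bcode (sym ins≡)) (Insertion.bcode-ins σ' σ'∈Bn b b∈)

decompose : ∀ {m} (σ : Vec ℤ (suc m)) → IsBn σ → Decomposition σ
decompose σ σ∈Bn = record { σ' = σ' ; b = b ; σ'∈Bn = del∈Bn ; b∈ = b∈ ; ins≡ = ins-del }
  where open Deletion σ σ∈Bn

IsSE-∷ʳ : ∀ {m} (c : Vec ℤ m) b → IsSE (c ∷ʳ b) ⇔ (IsSE c × InPM (suc m) b)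
IsSE-∷ʳ {m} c b = mk⇔ to from
  where
  to : IsSE (c ∷ʳ b) → IsSE c × InPM (suc m) b
  to cb∈SE =
    (λ i 1≤i i≤m → subst (λ a → a ≢ + 0 × ∣ a ∣ ≤ i) (at-∷ʳ c b i i≤m) (cb∈SE i 1≤i (ℕ.m≤n⇒m≤1+n i≤m))) ,
    subst (InPM (suc m)) (at-∷ʳ-last c b) (cb∈SE (suc m) (s≤s z≤n) ℕ.≤-refl)
  from : IsSE c × InPM (suc m) b → IsSE (c ∷ʳ b)
  from (c∈SE , b∈) i 1≤i i≤1+m with i ℕ.≟ suc m
  ... | yes refl = subst (InPM (suc m)) (sym (at-∷ʳ-last c b)) b∈
  ... | no  i≢N  = subst (λ a → a ≢ + 0 × ∣ a ∣ ≤ i) (sym (at-∷ʳ c b i i≤m)) (c∈SE i 1≤i i≤m)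
    where i≤m = ≤1+∧≢⇒≤ i≤1+m i≢N

[]∈Bn : IsBn []
[]∈Bn = (λ x x∈ → ⊥-elim (¬InPM-0 x∈)) , (λ x _ x∈ _ _ → ⊥-elim (¬InPM-0 x∈)) , (λ y y∈ → ⊥-elim (¬InPM-0 y∈))
  where
  ¬InPM-0 : ∀ {x} → ¬ InPM 0 x
  ¬InPM-0 (x≢0 , x≤0) = x≢0 (ℤ.∣i∣≡0⇒i≡0 (ℕ.n≤0⇒n≡0 x≤0))

bcode-IsSE : ∀ n (σ : Vec ℤ n) → IsBn σ → IsSE (bcode σ)
bcode-IsSE zero    σ σ∈Bn i 1≤i i≤0 = ⊥-elim (ℕ.<⇒≱ 1≤i i≤0)
bcode-IsSE (suc m) σ σ∈Bn =
  subst IsSE (sym bcode≡) (Equivalence.from (IsSE-∷ʳ (bcode σ') b) (bcode-IsSE m σ' σ'∈Bn , b∈))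
  where open Decomposition (decompose σ σ∈Bn)

bcode-injective : ∀ n (σ τ : Vec ℤ n) → IsBn σ → IsBn τ → bcode σ ≡ bcode τ → σ ≡ τ
bcode-injective zero    [] [] _ _ _ = refl
bcode-injective (suc m) σ τ σ∈Bn τ∈Bn eq = begin
  σ            ≡⟨ sym S.ins≡ ⟩
  ins S.σ' S.b ≡⟨ cong₂ ins (bcode-injective m S.σ' T.σ' S.σ'∈Bn T.σ'∈Bn (Vec.∷ʳ-injectiveˡ _ _ codes≡))
                          (Vec.∷ʳ-injectiveʳ (bcode S.σ') (bcode T.σ') codes≡) ⟩
  ins T.σ' T.b ≡⟨ T.ins≡ ⟩
  τ            ∎
  where
  open ≡-Reasoning
  module S = Decomposition (decompose σ σ∈Bn)
  module T = Decomposition (decompose τ τ∈Bn)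
  codes≡ : bcode S.σ' ∷ʳ S.b ≡ bcode T.σ' ∷ʳ T.b
  codes≡ = trans (sym S.bcode≡) (trans eq T.bcode≡)

bcode-surjective : ∀ n (a : Vec ℤ n) → IsSE a → ∃ λ σ → IsBn σ × bcode σ ≡ a
bcode-surjective zero    []    _    = [] , []∈Bn , refl
bcode-surjective (suc m) a a∈SE with initLast a
... | c , b , refl with Equivalence.to (IsSE-∷ʳ c b) a∈SE
...   | c∈SE , b∈ with bcode-surjective m c c∈SE
...     | σ' , σ'∈Bn , refl = ins σ' b , Insertion.ins∈Bn σ' σ'∈Bn b b∈ , Insertion.bcode-ins σ' σ'∈Bn b b∈

-- Cycles of |σ|

absPow≡fold : ∀ {n} (w : Vec ℤ n) k i → absPow w k i ≡ fold i (absσ w) k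
absPow≡fold w zero    i = refl
absPow≡fold w (suc k) i = cong (absσ w) (absPow≡fold w k i)

InOrbit : ∀ {n} → Vec ℤ n → ℕ → ℕ → Set
InOrbit w i j = ∃ λ k → absPow w k i ≡ j

InOrbit-start : ∀ {n} (w : Vec ℤ n) i → InOrbit w i i
InOrbit-start w i = 0 , refl

InOrbit-step : ∀ {n} (w : Vec ℤ n) {i j} → InOrbit w i j → InOrbit w i (absσ w j)
InOrbit-step w (k , refl) = suc k , refl

module AbsPerm {n} (w : Vec ℤ n) (w∈Bn : IsBn w) where
  open Inverse w w∈Bn

  at-InPM : ∀ {j} → InRange n j → InPM n (at w j)
  at-InPM {suc j} j∈ = app-InPM (+ suc j) (InRange⇒InPM j∈)

  absσ-InRange : ∀ {j} → InRange n j → InRange n (absσ w j)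
  absσ-InRange j∈ with at-InPM j∈
  ... | wj≢0 , ∣wj∣≤n = ≢0⇒1≤∣∣ wj≢0 , ∣wj∣≤n

  absσ-injective : ∀ {j k} → InRange n j → InRange n k → absσ w j ≡ absσ w k → j ≡ k
  absσ-injective {suc j} {suc k} j∈ k∈ eq with ∣∣≡∣∣⇒≡± (at w (suc j)) (at w (suc k)) eq
  ... | inj₁ wj≡wk with app-injective (+ suc j) (+ suc k) (InRange⇒InPM j∈) (InRange⇒InPM k∈) wj≡wk
  ...   | refl = refl
  absσ-injective {suc j} {suc k} j∈ k∈ eq | inj₂ wj≡-wk
    with app-injective (+ suc j) (- (+ suc k)) (InRange⇒InPM j∈) (InPM-neg (InRange⇒InPM k∈)) wj≡-wk
  ... | ()

  absPow-InRange : ∀ {i} k → InRange n i → InRange n (absPow w k i)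
  absPow-InRange zero    i∈ = i∈
  absPow-InRange (suc k) i∈ = absσ-InRange (absPow-InRange k i∈)

  InOrbit-bounded : ∀ {i j} → InRange n i → InOrbit w i j → ∃ λ k → k < n × absPow w k i ≡ j
  InOrbit-bounded {i} i∈ (k , refl) =
    case orbit-bounded (absσ w) [1‥ n ] (∈[1‥]⁺ ∘ absσ-InRange ∘ ∈[1‥]⁻)
           (λ j∈ k∈ → absσ-injective (∈[1‥]⁻ j∈) (∈[1‥]⁻ k∈)) (∈[1‥]⁺ i∈) k of λ
      { (r , r<len , same) → r , subst (r <_) len≡n r<len ,
                             trans (absPow≡fold w r i) (trans same (sym (absPow≡fold w k i))) }
    where len≡n = trans (length-map suc (upTo n)) (length-upTo n)

  inCycle⇔InOrbit : ∀ {i j} → InRange n i → T (inCycleᵇ w i j) ⇔ InOrbit w i j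
  inCycle⇔InOrbit {i} {j} i∈ = mk⇔
    (λ t → case find (any⁻ _ (upTo n) t) of λ { (k , _ , hit) → k , ℕ.≡ᵇ⇒≡ _ _ hit })
    (λ orb → case InOrbit-bounded i∈ orb of λ
       { (k , k<n , hit) → any⁺ _ (lose (∈-upTo⁺ k<n) (ℕ.≡⇒≡ᵇ _ _ hit)) })

module InsertionWord {m} (σ' : Vec ℤ m) (σ'∈Bn : IsBn σ') (b : ℤ) (b∈ : InPM (suc m) b) where
  open Transposition m b
  open Insertion σ' σ'∈Bn b b∈ using (σ; app-ins; ins∈Bn)

  at-ins-other : ∀ {j} → InRange m j → j ≢ ∣ b ∣ → at σ j ≡ at σ' j
  at-ins-other {j} j∈@(1≤j , _) j≢∣b∣ = begin
    at σ j                      ≡⟨ app-ins (+ j) (InPM-suc (InRange⇒InPM j∈)) ⟩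
    extend m (app σ') (τ (+ j)) ≡⟨ cong (extend m (app σ')) (trans (oddExt-+ τ⁺ 1≤j) (τ⁺-other j j≢∣b∣ j≢N)) ⟩
    extend m (app σ') (+ j)     ≡⟨ extend-other m (app σ') (+ j) j≢N ⟩
    at σ' j                     ∎
    where
    open ≡-Reasoning
    j≢N = InPM⇒∣∣≢suc (InRange⇒InPM j∈)

  at-ins-∣b∣ : at σ ∣ b ∣ ≡ signed b (+ N)
  at-ins-∣b∣ = begin
    at σ ∣ b ∣                         ≡⟨ app-ins (+ ∣ b ∣) (InRange⇒InPM (≢0⇒1≤∣∣ (proj₁ b∈) , proj₂ b∈)) ⟩
    extend m (app σ') (τ (+ ∣ b ∣))    ≡⟨ cong (extend m (app σ')) (τ-∣b∣ b∈) ⟩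
    extend m (app σ') (signed b (+ N)) ≡⟨ extend-N m (app σ') _ (∣signed∣ b (+ N)) ⟩
    signed b (+ N)                     ∎
    where open ≡-Reasoning

  at-ins-N : ∣ b ∣ ≢ N → at σ N ≡ app σ' b
  at-ins-N ∣b∣≢N = begin
    at σ N                      ≡⟨ app-ins (+ N) ((λ ()) , ℕ.≤-refl) ⟩
    extend m (app σ') (τ (+ N)) ≡⟨ cong (extend m (app σ')) (τ-N b∈) ⟩
    extend m (app σ') b         ≡⟨ extend-other m (app σ') b ∣b∣≢N ⟩
    app σ' b                    ∎
    where open ≡-Reasoning

  <∣b∣⇒≤m : ∀ {j} → j < ∣ b ∣ → j ≤ m
  <∣b∣⇒≤m j<∣b∣ = s≤s⁻¹ (ℕ.<-≤-trans j<∣b∣ (proj₂ b∈))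

  at-ins-below-∣b∣ : ∀ {j} → 1 ≤ j → j < ∣ b ∣ → at σ j ≡ at σ' j
  at-ins-below-∣b∣ 1≤j j<∣b∣ = at-ins-other (1≤j , <∣b∣⇒≤m j<∣b∣) (ℕ.<⇒≢ j<∣b∣)

  Lmap-ins : ∀ i → Lmap σ i ⇔ (+ i ≡ b ⊎ (Lmap σ' i × i < ∣ b ∣))
  Lmap-ins i = mk⇔ to from
    where
    to : Lmap σ i → + i ≡ b ⊎ (Lmap σ' i × i < ∣ b ∣)
    to (1≤i , i≤N , 0<σi , σi-max) with ℕ.<-cmp i ∣ b ∣
    ... | tri< i<∣b∣ _ _ = inj₂ ((1≤i , <∣b∣⇒≤m i<∣b∣ , subst (+ 0 <ℤ_) σi≡σ'i 0<σi , σ'i-max) , i<∣b∣)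
      where
      σi≡σ'i = at-ins-below-∣b∣ 1≤i i<∣b∣
      σ'i-max : ∀ j → 1 ≤ j → j < i → + ∣ at σ' j ∣ <ℤ at σ' i
      σ'i-max j 1≤j j<i = subst₂ (λ x y → + ∣ x ∣ <ℤ y) (at-ins-below-∣b∣ 1≤j (ℕ.<-trans j<i i<∣b∣)) σi≡σ'i
                                 (σi-max j 1≤j j<i)
    ... | tri≈ _ refl _ = inj₁ (sym (positive b (subst (+ 0 <ℤ_) at-ins-∣b∣ 0<σi)))
      where
      positive : ∀ b → + 0 <ℤ signed b (+ N) → b ≡ + ∣ b ∣
      positive (+ _) _ = refl
    ... | tri> _ _ ∣b∣<i = ⊥-elim (ℕ.<⇒≱ N<∣σi∣ (proj₂ (AbsPerm.at-InPM σ ins∈Bn (1≤i , i≤N))))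
      where
      N<∣σi∣ : N < ∣ at σ i ∣
      N<∣σi∣ = subst (_< ∣ at σ i ∣) (trans (cong ∣_∣ at-ins-∣b∣) (∣signed∣ b (+ N)))
                     (+<⇒<∣∣ (σi-max ∣ b ∣ (≢0⇒1≤∣∣ (proj₁ b∈)) ∣b∣<i))
    from : + i ≡ b ⊎ (Lmap σ' i × i < ∣ b ∣) → Lmap σ i
    from (inj₁ refl) = ≢0⇒1≤∣∣ (proj₁ b∈) , proj₂ b∈ , subst (+ 0 <ℤ_) (sym at-ins-∣b∣) (+<+ (s≤s z≤n)) , N-max
      where
      N-max : ∀ j → 1 ≤ j → j < i → + ∣ at σ j ∣ <ℤ at σ i
      N-max j 1≤j j<i = subst₂ (λ x y → + ∣ x ∣ <ℤ y) (sym (at-ins-below-∣b∣ 1≤j j<i)) (sym at-ins-∣b∣)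
                               (+<+ (s≤s (proj₂ (AbsPerm.at-InPM σ' σ'∈Bn (1≤j , <∣b∣⇒≤m j<i)))))
    from (inj₂ ((1≤i , i≤m , 0<σ'i , σ'i-max) , i<∣b∣)) =
      1≤i , ℕ.m≤n⇒m≤1+n i≤m , subst (+ 0 <ℤ_) (sym σi≡σ'i) 0<σ'i , σi-max
      where
      σi≡σ'i = at-ins-below-∣b∣ 1≤i i<∣b∣
      σi-max : ∀ j → 1 ≤ j → j < i → + ∣ at σ j ∣ <ℤ at σ i
      σi-max j 1≤j j<i = subst₂ (λ x y → + ∣ x ∣ <ℤ y) (sym (at-ins-below-∣b∣ 1≤j (ℕ.<-trans j<i i<∣b∣)))
                                (sym σi≡σ'i) (σ'i-max j 1≤j j<i)

Rmil-∷ʳ : ∀ {m} (c : Vec ℤ m) b → InPM (suc m) b →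
          ∀ v → Rmil (c ∷ʳ b) v ⇔ (+ v ≡ b ⊎ (Rmil c v × v < ∣ b ∣))
Rmil-∷ʳ {m} c b b∈ v = mk⇔ to from
  where
  to : Rmil (c ∷ʳ b) v → + v ≡ b ⊎ (Rmil c v × v < ∣ b ∣)
  to (i , 1≤i , i≤1+m , cbi≡v , 0<v , v-min) with i ℕ.≟ suc m
  ... | yes refl = inj₁ (trans (sym cbi≡v) (at-∷ʳ-last c b))
  ... | no  i≢N  =
    inj₂ ((i , 1≤i , i≤m , trans (sym (at-∷ʳ c b i i≤m)) cbi≡v , 0<v ,
           λ j i<j j≤m → subst (λ x → v < ∣ x ∣) (at-∷ʳ c b j j≤m) (v-min j i<j (ℕ.m≤n⇒m≤1+n j≤m))) ,
          subst (λ x → v < ∣ x ∣) (at-∷ʳ-last c b) (v-min (suc m) (s≤s i≤m) ℕ.≤-refl))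
    where i≤m = ≤1+∧≢⇒≤ i≤1+m i≢N
  from : + v ≡ b ⊎ (Rmil c v × v < ∣ b ∣) → Rmil (c ∷ʳ b) v
  from (inj₁ refl) =
    suc m , s≤s z≤n , ℕ.≤-refl , at-∷ʳ-last c b , ≢0⇒1≤∣∣ (proj₁ b∈) ,
    λ j 1+m<j j≤1+m → ⊥-elim (ℕ.<⇒≱ 1+m<j j≤1+m)
  from (inj₂ ((i , 1≤i , i≤m , ci≡v , 0<v , v-min) , v<∣b∣)) =
    i , 1≤i , ℕ.m≤n⇒m≤1+n i≤m , trans (at-∷ʳ c b i i≤m) ci≡v , 0<v , v-min′
    where
    v-min′ : ∀ j → i < j → j ≤ suc m → v < ∣ at (c ∷ʳ b) j ∣
    v-min′ j i<j j≤1+m with j ℕ.≟ suc m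
    ... | yes refl = subst (λ x → v < ∣ x ∣) (sym (at-∷ʳ-last c b)) v<∣b∣
    ... | no  j≢N  = subst (λ x → v < ∣ x ∣) (sym (at-∷ʳ c b j j≤m)) (v-min j i<j j≤m)
      where j≤m = ≤1+∧≢⇒≤ j≤1+m j≢N

Max-∷ʳ : ∀ {m} (c : Vec ℤ m) b i → Max (c ∷ʳ b) i ⇔ ((i ≡ suc m × b ≡ + suc m) ⊎ Max c i)
Max-∷ʳ {m} c b i = mk⇔ to from
  where
  to : Max (c ∷ʳ b) i → (i ≡ suc m × b ≡ + suc m) ⊎ Max c i
  to (1≤i , i≤1+m , cbi≡i) with i ℕ.≟ suc m
  ... | yes refl = inj₁ (refl , trans (sym (at-∷ʳ-last c b)) cbi≡i)
  ... | no  i≢N  = inj₂ (1≤i , i≤m , trans (sym (at-∷ʳ c b i i≤m)) cbi≡i)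
    where i≤m = ≤1+∧≢⇒≤ i≤1+m i≢N
  from : (i ≡ suc m × b ≡ + suc m) ⊎ Max c i → Max (c ∷ʳ b) i
  from (inj₁ (refl , b≡N))       = s≤s z≤n , ℕ.≤-refl , trans (at-∷ʳ-last c b) b≡N
  from (inj₂ (1≤i , i≤m , ci≡i)) = 1≤i , ℕ.m≤n⇒m≤1+n i≤m , trans (at-∷ʳ c b i i≤m) ci≡i

bit : Bool → ℕ
bit true  = 1
bit false = 0

count : (ℕ → Bool) → List ℕ → ℕ
count p []       = 0
count p (x ∷ xs) = bit (p x) + count p xs

length-filterᵇ : ∀ p xs → length (filterᵇ p xs) ≡ count p xs
length-filterᵇ p []       = refl
length-filterᵇ p (x ∷ xs) with p x
... | true  = cong suc (length-filterᵇ p xs)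
... | false = length-filterᵇ p xs

count-++ : ∀ p xs ys → count p (xs ++ ys) ≡ count p xs + count p ys
count-++ p []       ys = refl
count-++ p (x ∷ xs) ys =
  trans (cong (λ c → bit (p x) + c) (count-++ p xs ys)) (sym (ℕ.+-assoc (bit (p x)) _ _))

count-cong : ∀ p q s L → (∀ k → s ≤ k → k < s + L → p k ≡ q k) →
             count p (range s L) ≡ count q (range s L)
count-cong p q s zero    _   = refl
count-cong p q s (suc L) p≗q = cong₂ _+_ (cong bit (p≗q s ℕ.≤-refl (ℕ.m<m+n s (s≤s z≤n))))
  (count-cong p q (suc s) L λ k s<k k<s+L → p≗q k (ℕ.<⇒≤ s<k) (subst (k <_) (sym (ℕ.+-suc s L)) k<s+L))

count-swap : ∀ p q B s L → s ≤ B → B < s + L → (∀ k → s ≤ k → k < s + L → k ≢ B → p k ≡ q k) →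
             count p (range s L) + bit (q B) ≡ count q (range s L) + bit (p B)
count-swap p q B s zero s≤B B<s+0 _ =
  ⊥-elim (ℕ.<⇒≱ B<s+0 (subst (_≤ B) (sym (ℕ.+-identityʳ s)) s≤B))
count-swap p q B s (suc L) s≤B B<s+L p≗q with s ℕ.≟ B
... | yes refl = begin
  (bit (p s) + count p rest) + bit (q s) ≡⟨ cong (λ c → (bit (p s) + c) + bit (q s)) rest-same ⟩
  (bit (p s) + count q rest) + bit (q s) ≡⟨ xy∙z≈zy∙x (bit (p s)) _ _ ⟩
  (bit (q s) + count q rest) + bit (p s) ∎
  where
  open ≡-Reasoning
  rest = range (suc s) L
  rest-same = count-cong p q (suc s) L λ k s<k k<s+L →
    p≗q k (ℕ.<⇒≤ s<k) (subst (k <_) (sym (ℕ.+-suc s L)) k<s+L) (ℕ.>⇒≢ s<k)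
... | no s≢B = begin
  (bit (p s) + count p rest) + bit (q B) ≡⟨ ℕ.+-assoc (bit (p s)) _ _ ⟩
  bit (p s) + (count p rest + bit (q B)) ≡⟨ cong₂ _+_ (cong bit ps≡qs) swapped ⟩
  bit (q s) + (count q rest + bit (p B)) ≡⟨ sym (ℕ.+-assoc (bit (q s)) _ _) ⟩
  (bit (q s) + count q rest) + bit (p B) ∎
  where
  open ≡-Reasoning
  rest = range (suc s) L
  ps≡qs = p≗q s ℕ.≤-refl (ℕ.m<m+n s (s≤s z≤n)) s≢B
  swapped = count-swap p q B (suc s) L (ℕ.≤∧≢⇒< s≤B s≢B) (subst (B <_) (ℕ.+-suc s L) B<s+L)
    λ k s<k k<s+L → p≗q k (ℕ.<⇒≤ s<k) (subst (k <_) (sym (ℕ.+-suc s L)) k<s+L)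

even-⇔ : ∀ {X Y a c} → X + a ≡ Y + c → c ≡ a ⊎ c ≡ a + 2 → (2 ∣ X) ⇔ (2 ∣ Y)
even-⇔ {X} {Y} {a} eq (inj₁ refl) with ℕ.+-cancelʳ-≡ a X Y eq
... | refl = mk⇔ (λ 2∣X → 2∣X) (λ 2∣Y → 2∣Y)
even-⇔ {X} {Y} {a} eq (inj₂ refl)
  with ℕ.+-cancelʳ-≡ a X (Y + 2) (trans eq (sym (trans (xy∙z≈xz∙y Y 2 a) (ℕ.+-assoc Y a 2))))
... | refl = mk⇔ (λ 2∣Y+2 → ∣m+n∣m⇒∣n (subst (2 ∣_) (ℕ.+-comm Y 2) 2∣Y+2) ∣-refl) (λ 2∣Y → ∣m∣n⇒∣m+n 2∣Y ∣-refl)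

T-⇔⇒≡ : ∀ {x y} → (T x ⇔ T y) → x ≡ y
T-⇔⇒≡ {true}  {true}  _ = refl
T-⇔⇒≡ {true}  {false} h = ⊥-elim (Equivalence.to h _)
T-⇔⇒≡ {false} {true}  h = ⊥-elim (Equivalence.from h _)
T-⇔⇒≡ {false} {false} _ = refl

¬T⇒≡false : ∀ {x} → ¬ T x → x ≡ false
¬T⇒≡false {true}  ¬t = ⊥-elim (¬t _)
¬T⇒≡false {false} _  = refl

isNeg : ℤ → Bool
isNeg x = does (x ℤ.<? + 0)

negIn : ∀ {n} → Vec ℤ n → ℕ → ℕ → Bool
negIn w i j = if inCycleᵇ w i j then negᵇ w j else false

negCount≡count : ∀ {n} (w : Vec ℤ n) i → negCount w i ≡ count (negIn w i) (range 1 n)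
negCount≡count {n} w i =
  trans (length-filterᵇ (negIn w i) [1‥ n ]) (cong (count (negIn w i)) ([1‥]≡range n))

-- The entries sgn(b)·N and sgn(b)·y that replace the entry y of a cycle add 0 or 2 negative entries.
bits-parity : ∀ c b N y → y ≢ + 0 →
  let before = bit (if c then isNeg y else false)
      after  = bit (if c then isNeg (signed b (+ suc N)) else false) +
               bit (if c then isNeg (signed b y) else false)
  in after ≡ before ⊎ after ≡ before + 2
bits-parity false _        _ _         _   = inj₁ refl
bits-parity true  (+ _)    _ _         _   = inj₁ refl
bits-parity true  -[1+ _ ] _ (+ zero)  y≢0 = ⊥-elim (y≢0 refl)
bits-parity true  -[1+ _ ] _ (+ suc _) _   = inj₂ refl
bits-parity true  -[1+ _ ] _ -[1+ _ ]  _   = inj₁ refl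

module InsertionCycles {m} (σ' : Vec ℤ m) (σ'∈Bn : IsBn σ') (b : ℤ) (b∈ : InPM (suc m) b) where
  open Transposition m b using (N)
  open Insertion σ' σ'∈Bn b b∈ using (σ; ins∈Bn)
  open InsertionWord σ' σ'∈Bn b b∈
  module Old = AbsPerm σ' σ'∈Bn
  module New = AbsPerm σ ins∈Bn

  B : ℕ
  B = ∣ b ∣

  B∈ : B ≢ N → InRange m B
  B∈ B≢N = ≢0⇒1≤∣∣ (proj₁ b∈) , ≤1+∧≢⇒≤ (proj₂ b∈) B≢N

  absσ-ins-other : ∀ {j} → InRange m j → j ≢ B → absσ σ j ≡ absσ σ' j
  absσ-ins-other j∈ j≢B = cong ∣_∣ (at-ins-other j∈ j≢B)

  absσ-ins-B : absσ σ B ≡ N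
  absσ-ins-B = trans (cong ∣_∣ at-ins-∣b∣) (∣signed∣ b (+ N))

  absσ-ins-N : B ≢ N → absσ σ N ≡ absσ σ' B
  absσ-ins-N B≢N = trans (cong ∣_∣ (trans (at-ins-N B≢N) (app≡signed σ' b))) (∣signed∣ b _)

  negCount-ins : ∀ i → negCount σ i ≡ count (negIn σ i) (range 1 m) + bit (negIn σ i N)
  negCount-ins i = begin
    negCount σ i                                          ≡⟨ negCount≡count σ i ⟩
    count (negIn σ i) (range 1 N)                         ≡⟨ cong (count (negIn σ i)) (range-∷ʳ 1 m) ⟩
    count (negIn σ i) (range 1 m ++ (N ∷ []))             ≡⟨ count-++ (negIn σ i) (range 1 m) (N ∷ []) ⟩
    count (negIn σ i) (range 1 m) + (bit (negIn σ i N) + 0)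
      ≡⟨ cong (λ x → count (negIn σ i) (range 1 m) + x) (ℕ.+-identityʳ _) ⟩
    count (negIn σ i) (range 1 m) + bit (negIn σ i N)     ∎
    where open ≡-Reasoning

  module _ {i} (i∈ : InRange m i) where

    i∈N : InRange N i
    i∈N = proj₁ i∈ , ℕ.m≤n⇒m≤1+n (proj₂ i∈)

    old-step : ∀ {y} → InRange m y → InOrbit σ i y → InOrbit σ i (absσ σ' y)
    old-step {y} y∈ orb with y ℕ.≟ B
    ... | no  y≢B  = subst (InOrbit σ i) (absσ-ins-other y∈ y≢B) (InOrbit-step σ orb)
    ... | yes refl = subst (InOrbit σ i) two-steps (InOrbit-step σ (InOrbit-step σ orb))
      where two-steps = trans (cong (absσ σ) absσ-ins-B) (absσ-ins-N (ℕ.<⇒≢ (s≤s (proj₂ y∈))))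

    old⇒new : ∀ k → InOrbit σ i (absPow σ' k i)
    old⇒new zero    = InOrbit-start σ i
    old⇒new (suc k) = old-step (Old.absPow-InRange k i∈) (old⇒new k)

    NewOrbitPoint : ℕ → Set
    NewOrbitPoint y = (y ≤ m × InOrbit σ' i y) ⊎ (y ≡ N × B ≢ N × InOrbit σ' i B)

    new-step : ∀ {y} → 1 ≤ y → NewOrbitPoint y → NewOrbitPoint (absσ σ y)
    new-step _ (inj₂ (refl , B≢N , orb)) =
      inj₁ (subst (_≤ m) (sym (absσ-ins-N B≢N)) (proj₂ (Old.absσ-InRange (B∈ B≢N))) ,
            subst (InOrbit σ' i) (sym (absσ-ins-N B≢N)) (InOrbit-step σ' orb))
    new-step {y} 1≤y (inj₁ (y≤m , orb)) with y ℕ.≟ B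
    ... | yes refl = inj₂ (absσ-ins-B , ℕ.<⇒≢ (s≤s y≤m) , orb)
    ... | no  y≢B  = inj₁ (subst (_≤ m) (sym e) (proj₂ (Old.absσ-InRange (1≤y , y≤m))) ,
                           subst (InOrbit σ' i) (sym e) (InOrbit-step σ' orb))
      where e = absσ-ins-other (1≤y , y≤m) y≢B

    new⇒old : ∀ k → NewOrbitPoint (absPow σ k i)
    new⇒old zero    = inj₁ (proj₂ i∈ , InOrbit-start σ' i)
    new⇒old (suc k) = new-step (proj₁ (New.absPow-InRange k i∈N)) (new⇒old k)

    InOrbit-ins : ∀ {j} → j ≤ m → InOrbit σ i j ⇔ InOrbit σ' i j
    InOrbit-ins j≤m = mk⇔
      (λ { (k , refl) → case new⇒old k of λ
             { (inj₁ (_ , orb))   → orb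
             ; (inj₂ (y≡N , _)) → ⊥-elim (ℕ.1+n≰n (subst (_≤ m) y≡N j≤m)) } })
      (λ { (k , refl) → old⇒new k })

    N-InOrbit-ins : InOrbit σ i N ⇔ (B ≢ N × InOrbit σ' i B)
    N-InOrbit-ins = mk⇔
      (λ { (k , y≡N) → case new⇒old k of λ
             { (inj₁ (y≤m , _))       → ⊥-elim (ℕ.1+n≰n (subst (_≤ m) y≡N y≤m))
             ; (inj₂ (_ , B≢N , orb)) → B≢N , orb } })
      (λ { (B≢N , orb) → subst (InOrbit σ i) absσ-ins-B
                           (InOrbit-step σ (Equivalence.from (InOrbit-ins (proj₂ (B∈ B≢N))) orb)) })

    min-ins : (∀ k → i ≤ absPow σ k i) ⇔ (∀ k → i ≤ absPow σ' k i)
    min-ins = mk⇔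
      (λ min k → case old⇒new k of λ { (k′ , e) → subst (i ≤_) e (min k′) })
      (λ min k → case new⇒old k of λ
         { (inj₁ (_ , (k′ , e))) → subst (i ≤_) e (min k′)
         ; (inj₂ (y≡N , _))     → subst (i ≤_) (sym y≡N) (proj₂ i∈N) })

    inCycle-ins : ∀ {j} → j ≤ m → inCycleᵇ σ i j ≡ inCycleᵇ σ' i j
    inCycle-ins j≤m =
      T-⇔⇒≡ (⇔-sym (Old.inCycle⇔InOrbit i∈) ⇔-∘ (InOrbit-ins j≤m ⇔-∘ New.inCycle⇔InOrbit i∈N))

    N-inCycle-ins : B ≢ N → inCycleᵇ σ i N ≡ inCycleᵇ σ' i B
    N-inCycle-ins B≢N = T-⇔⇒≡ (⇔-sym (Old.inCycle⇔InOrbit i∈) ⇔-∘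
                                 (mk⇔ proj₂ (B≢N ,_) ⇔-∘ (N-InOrbit-ins ⇔-∘ New.inCycle⇔InOrbit i∈N)))

    negIn-ins : ∀ k → 1 ≤ k → k < 1 + m → k ≢ B → negIn σ i k ≡ negIn σ' i k
    negIn-ins k 1≤k k<1+m k≢B = cong₂ (λ c s → if c then s else false) (inCycle-ins (s≤s⁻¹ k<1+m))
                                      (cong isNeg (at-ins-other (1≤k , s≤s⁻¹ k<1+m) k≢B))

    bits-ins : B ≢ N →
      let before = bit (negIn σ' i B) ; after = bit (negIn σ i B) + bit (negIn σ i N)
      in after ≡ before ⊎ after ≡ before + 2
    bits-ins B≢N = subst₂ (λ u v → bit u + bit v ≡ r ⊎ bit u + bit v ≡ r + 2) (sym at-B) (sym at-N)
                     (bits-parity c b m (at σ' B) (proj₁ (Old.at-InPM (B∈ B≢N))))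
      where
      c = inCycleᵇ σ' i B
      r = bit (negIn σ' i B)
      at-B : negIn σ i B ≡ (if c then isNeg (signed b (+ N)) else false)
      at-B = cong₂ (λ c s → if c then s else false) (inCycle-ins (proj₂ (B∈ B≢N))) (cong isNeg at-ins-∣b∣)
      at-N : negIn σ i N ≡ (if c then isNeg (signed b (at σ' B)) else false)
      at-N = cong₂ (λ c s → if c then s else false) (N-inCycle-ins B≢N)
                   (cong isNeg (trans (at-ins-N B≢N) (app≡signed σ' b)))

    negCount-ins-B≡N : B ≡ N → negCount σ i ≡ negCount σ' i
    negCount-ins-B≡N B≡N = begin
      negCount σ i                                      ≡⟨ negCount-ins i ⟩
      count (negIn σ i) (range 1 m) + bit (negIn σ i N) ≡⟨ cong₂ _+_ same-below N-absent ⟩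
      count (negIn σ' i) (range 1 m) + 0                ≡⟨ ℕ.+-identityʳ _ ⟩
      count (negIn σ' i) (range 1 m)                    ≡⟨ sym (negCount≡count σ' i) ⟩
      negCount σ' i                                     ∎
      where
      open ≡-Reasoning
      same-below = count-cong (negIn σ i) (negIn σ' i) 1 m λ k 1≤k k<1+m →
        negIn-ins k 1≤k k<1+m (λ k≡B → ℕ.<⇒≢ k<1+m (trans k≡B B≡N))
      N-absent : bit (negIn σ i N) ≡ 0
      N-absent = cong (λ c → bit (if c then negᵇ σ N else false)) (¬T⇒≡false λ t →
        proj₁ (Equivalence.to N-InOrbit-ins (Equivalence.to (New.inCycle⇔InOrbit i∈N) t)) B≡N)

    negCount-ins-B≢N : B ≢ N →
      let a′ = bit (negIn σ' i B) ; aB = bit (negIn σ i B) ; aN = bit (negIn σ i N)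
      in negCount σ i + a′ ≡ negCount σ' i + (aB + aN)
    negCount-ins-B≢N B≢N = begin
      negCount σ i + a′         ≡⟨ cong (_+ a′) (negCount-ins i) ⟩
      (C + aN) + a′             ≡⟨ xy∙z≈xz∙y C aN a′ ⟩
      (C + a′) + aN             ≡⟨ cong (_+ aN) swapped ⟩
      (C′ + aB) + aN            ≡⟨ ℕ.+-assoc C′ aB aN ⟩
      C′ + (aB + aN)            ≡⟨ cong (_+ (aB + aN)) (sym (negCount≡count σ' i)) ⟩
      negCount σ' i + (aB + aN) ∎
      where
      open ≡-Reasoning
      C = count (negIn σ i) (range 1 m)
      C′ = count (negIn σ' i) (range 1 m)
      aN = bit (negIn σ i N)
      aB = bit (negIn σ i B)
      a′ = bit (negIn σ' i B)
      swapped = count-swap (negIn σ i) (negIn σ' i) B 1 m (proj₁ (B∈ B≢N)) (s≤s (proj₂ (B∈ B≢N))) negIn-ins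

    even-negCount-ins : (2 ∣ negCount σ i) ⇔ (2 ∣ negCount σ' i)
    even-negCount-ins = case B ℕ.≟ N of λ
      { (yes B≡N) → even-⇔ {a = 0} {c = 0} (cong (_+ 0) (negCount-ins-B≡N B≡N)) (inj₁ refl)
      ; (no  B≢N) → even-⇔ (negCount-ins-B≢N B≢N) (bits-ins B≢N) }

    Cyc-ins-old : Cyc σ i ⇔ Cyc σ' i
    Cyc-ins-old = mk⇔
      (λ { (1≤i , _ , min , even) →
             1≤i , proj₂ i∈ , Equivalence.to min-ins min , Equivalence.to even-negCount-ins even })
      (λ { (1≤i , _ , min , even) →
             1≤i , proj₂ i∈N , Equivalence.from min-ins min , Equivalence.from even-negCount-ins even })

  module _ (B≡N : B ≡ N) where

    absPow-N : ∀ k → absPow σ k N ≡ N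
    absPow-N zero    = refl
    absPow-N (suc k) = trans (cong (absσ σ) (absPow-N k)) (subst (λ j → absσ σ j ≡ N) B≡N absσ-ins-B)

    N∈N : InRange N N
    N∈N = s≤s z≤n , ℕ.≤-refl

    negCount-N : negCount σ N ≡ bit (isNeg b)
    negCount-N = begin
      negCount σ N                                      ≡⟨ negCount-ins N ⟩
      count (negIn σ N) (range 1 m) + bit (negIn σ N N) ≡⟨ cong₂ _+_ none-below (cong bit N-entry) ⟩
      count (λ _ → false) (range 1 m) + bit (isNeg b)   ≡⟨ cong (_+ bit (isNeg b)) (count-false (range 1 m)) ⟩
      bit (isNeg b)                                     ∎
      where
      open ≡-Reasoning
      count-false : ∀ xs → count (λ _ → false) xs ≡ 0
      count-false []       = refl
      count-false (_ ∷ xs) = count-false xs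
      none-below = count-cong (negIn σ N) (λ _ → false) 1 m λ k _ k<1+m →
        cong (λ c → if c then negᵇ σ k else false) (¬T⇒≡false λ t →
          case Equivalence.to (New.inCycle⇔InOrbit N∈N) t of λ
            { (r , e) → ℕ.<⇒≢ k<1+m (trans (sym e) (absPow-N r)) })
      N-in-cycle : inCycleᵇ σ N N ≡ true
      N-in-cycle = T-⇔⇒≡ (mk⇔ (λ _ → _) (λ _ → Equivalence.from (New.inCycle⇔InOrbit N∈N) (InOrbit-start σ N)))
      N-entry : negIn σ N N ≡ isNeg b
      N-entry = begin
        negIn σ N N            ≡⟨ cong (λ c → if c then negᵇ σ N else false) N-in-cycle ⟩
        isNeg (at σ N)         ≡⟨ cong isNeg (trans (cong (at σ) (sym B≡N)) at-ins-∣b∣) ⟩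
        isNeg (signed b (+ N)) ≡⟨ cong (λ j → isNeg (signed b (+ j))) (sym B≡N) ⟩
        isNeg (signed b (+ B)) ≡⟨ cong isNeg (signed-∣∣ b) ⟩
        isNeg b                ∎

  Cyc-ins-N : Cyc σ N ⇔ b ≡ + N
  Cyc-ins-N = mk⇔ to from
    where
    2∤1 : ¬ (2 ∣ 1)
    2∤1 2∣1 with () ← ∣1⇒≡1 2∣1
    to : Cyc σ N → b ≡ + N
    to (_ , _ , min , even) = case B ℕ.≟ N of λ
      { (no B≢N)  → ⊥-elim (ℕ.1+n≰n (ℕ.≤-trans (subst (N ≤_) (absσ-ins-N B≢N) (min 1))
                                                (proj₂ (Old.absσ-InRange (B∈ B≢N)))))
      ; (yes B≡N) → case ∣∣≡⇒± B≡N of λ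
          { (inj₁ b≡N)  → b≡N
          ; (inj₂ b≡-N) → ⊥-elim (2∤1 (subst (2 ∣_) (trans (negCount-N B≡N) (cong (bit ∘ isNeg) b≡-N)) even)) } }
    from : b ≡ + N → Cyc σ N
    from b≡N = s≤s z≤n , ℕ.≤-refl , (λ k → ℕ.≤-reflexive (sym (absPow-N B≡N k))) ,
               subst (2 ∣_) (sym (trans (negCount-N B≡N) (cong (bit ∘ isNeg) b≡N))) (divides 0 refl)
      where B≡N = cong ∣_∣ b≡N

  Cyc-ins : ∀ i → Cyc σ i ⇔ ((i ≡ N × b ≡ + N) ⊎ Cyc σ' i)
  Cyc-ins i = mk⇔ to from
    where
    to : Cyc σ i → (i ≡ N × b ≡ + N) ⊎ Cyc σ' i
    to c@(1≤i , i≤N , _) = case i ℕ.≟ N of λ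
      { (yes i≡N) → inj₁ (i≡N , Equivalence.to Cyc-ins-N (subst (Cyc σ) i≡N c))
      ; (no  i≢N) → inj₂ (Equivalence.to (Cyc-ins-old (1≤i , ≤1+∧≢⇒≤ i≤N i≢N)) c) }
    from : (i ≡ N × b ≡ + N) ⊎ Cyc σ' i → Cyc σ i
    from (inj₁ (refl , b≡N))      = Equivalence.from Cyc-ins-N b≡N
    from (inj₂ c@(1≤i , i≤m , _)) = Equivalence.from (Cyc-ins-old (1≤i , i≤m)) c

bcode-statistics : ∀ n (σ : Vec ℤ n) → IsBn σ →
                   (∀ i → Cyc σ i ⇔ Max (bcode σ) i) × (∀ i → Lmap σ i ⇔ Rmil (bcode σ) i)
bcode-statistics zero [] _ =
  (λ i → mk⇔ (λ { (1≤i , i≤0 , _) → ⊥-elim (ℕ.<⇒≱ 1≤i i≤0) })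
             (λ { (1≤i , i≤0 , _) → ⊥-elim (ℕ.<⇒≱ 1≤i i≤0) })) ,
  (λ i → mk⇔ (λ { (1≤i , i≤0 , _) → ⊥-elim (ℕ.<⇒≱ 1≤i i≤0) })
             (λ { (_ , 1≤j , j≤0 , _) → ⊥-elim (ℕ.<⇒≱ 1≤j j≤0) }))
bcode-statistics (suc m) σ σ∈Bn = Cyc⇔Max , Lmap⇔Rmil
  where
  open Decomposition (decompose σ σ∈Bn)
  IH = bcode-statistics m σ' σ'∈Bn
  Cyc⇔Max : ∀ i → Cyc σ i ⇔ Max (bcode σ) i
  Cyc⇔Max i = subst₂ (λ ρ c → Cyc ρ i ⇔ Max c i) ins≡ (sym bcode≡)
    (⇔-sym (Max-∷ʳ (bcode σ') b i) ⇔-∘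
      ((⇔-id _ ⊎-⇔ proj₁ IH i) ⇔-∘ InsertionCycles.Cyc-ins σ' σ'∈Bn b b∈ i))
  Lmap⇔Rmil : ∀ i → Lmap σ i ⇔ Rmil (bcode σ) i
  Lmap⇔Rmil i = subst₂ (λ ρ c → Lmap ρ i ⇔ Rmil c i) ins≡ (sym bcode≡)
    (⇔-sym (Rmil-∷ʳ (bcode σ') b b∈ i) ⇔-∘
      ((⇔-id _ ⊎-⇔ (proj₂ IH i ×-⇔ ⇔-id _)) ⇔-∘ InsertionWord.Lmap-ins σ' σ'∈Bn b b∈ i))

theorem3p4 : ∀ (n : ℕ) → 1 ≤ n →
    (∀ (σ : Vec ℤ n) → IsBn σ → IsSE (bcode σ))
    × (∀ (σ τ : Vec ℤ n) → IsBn σ → IsBn τ → bcode σ ≡ bcode τ → σ ≡ τ)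
    × (∀ (a : Vec ℤ n) → IsSE a → ∃ λ σ → IsBn σ × bcode σ ≡ a)
    × (∀ (σ : Vec ℤ n) → IsBn σ →
         (∀ i → Cyc σ i ⇔ Max (bcode σ) i)
       × (∀ i → Lmap σ i ⇔ Rmil (bcode σ) i))
theorem3p4 n _ = bcode-IsSE n , bcode-injective n , bcode-surjective n , bcode-statistics n
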